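{- The satisfiability problem and the finite satisfiability problem of $\mathrm{LTL}(\sim)$ are logspace-reducible to $\mathbf{\Delta^3_0}$.
   Context: Traces are infinite sequences of subsets of a countably infinite set $\mathsf{AP}$; $t^i$ is the suffix from position $i$; teams are sets of traces, $T^i=\{t^i\mid t\in T\}$. $\mathrm{LTL}(\sim)$-formulas: $\varphi::=p\mid\neg\varphi\mid\varphi\wedge\varphi\mid\varphi\vee\varphi\mid\mathsf X\varphi\mid\mathsf F\varphi\mid\mathsf G\varphi\mid\varphi\mathsf U\varphi\mid\varphi\mathsf R\varphi\mid{\sim}\varphi$ with synchronous team semantics: $T\models p$ iff $p\in t(0)$ for all $t\in T$; $T\models\neg\varphi$ iff $\{t\}\not\models\varphi$ for all $t\in T$; $\wedge$ as usual; $T\models\varphi\vee\psi$ iff $T=S\cup U$, $S\models\varphi$, $U\models\psi$; $T\models\mathsf X\varphi$ iff $T^1\models\varphi$; $T\models\mathsf F\varphi$ iff $\exists k\,T^k\models\varphi$; $T\models\mathsf G\varphi$ iff $\forall k\,T^k\models\varphi$; $T\models\varphi\mathsf U\psi$ iff $\exists k(T^k\models\psi\wedge\forall j<k\,T^j\models\varphi)$; $T\models\varphi\mathsf R\psi$ iff $\forall k(T^k\models\psi\vee\exists j<k\,T^j\models\varphi)$; $T\models{\sim}\varphi$ iff $T\not\models\varphi$. The satisfiability problem is the set of formulas true in some team; the finite satisfiability problem is the set of formulas true in $T(\mathcal K)$ for some finite Kripke structure $\mathcal K=(W,R,\eta,r)$ (finite $W$, serial $R$, $\eta:W\to\wp\mathsf{AP}$,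 root $r$), where $T(\mathcal K)$ is the set of traces $(\eta(\pi(i)))_i$ of $R$-paths $\pi$ starting at $r$. $\mathbf{\Delta^3_0}$ is the set of closed formulas of third-order arithmetic (vocabulary $(+,\times,0,1,=,\le)$) true in the standard model $\mathbb N$. -}

module Defs where

open import Level using (Level; _⊔_; Lift; 0ℓ) renaming (suc to lsuc)
open import Data.Nat using (ℕ; zero; suc; _+_; _*_; _≤_; _<_; _≡ᵇ_)
open import Data.Nat.Logarithm using (⌊log₂_⌋)
import Data.Nat.Binary as B
open import Data.Bool using (Bool; true; false; if_then_else_)
open import Data.Fin using (Fin; #_; toℕ) renaming (zero to fz; suc to fs)
open import Data.List using (List; []; _∷_; _++_; [_]; map; length)
open import Data.Maybe using (Maybe; just; nothing)
open import Data.Product using (Σ; _×_; _,_)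
open import Data.Sum using (_⊎_)
open import Relation.Nullary using (¬_)
open import Relation.Binary.PropositionalEquality using (_≡_)
open import Function.Bundles using (_⇔_)

data LTL : Set where
  prop : ℕ → LTL
  neg  : LTL → LTL
  _∧ᴸ_ : LTL → LTL → LTL
  _∨ᴸ_ : LTL → LTL → LTL
  Xᴸ   : LTL → LTL
  Fᴸ   : LTL → LTL
  Gᴸ   : LTL → LTL
  _Uᴸ_ : LTL → LTL → LTL
  _Rᴸ_ : LTL → LTL → LTL
  ∼ᴸ   : LTL → LTL

-- A trace t : ℕ → ℘(AP), written as characteristic functions:
-- t i p ≡ true  iff  p ∈ t(i).
Trace : Set
Trace = ℕ → ℕ → Bool

_≈ₜ_ : Trace → Trace → Set
t ≈ₜ u = ∀ i p → t i p ≡ u i p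

suffix : ℕ → Trace → Trace
suffix k t i = t (k + i)

Team : Set₁
Team = Trace → Set

_^ᵀ_ : Team → ℕ → Team
(T ^ᵀ k) u = Σ Trace λ t → T t × (suffix k t ≈ₜ u)

single : Trace → Team
single t u = u ≈ₜ t

_≡∪_,_ : Team → Team → Team → Set
T ≡∪ S , U = ∀ t → T t ⇔ (S t ⊎ U t)

infix 4 _⊨_
_⊨_ : Team → LTL → Set₁
T ⊨ prop p   = ∀ t → T t → Lift (lsuc 0ℓ) (t 0 p ≡ true)
T ⊨ neg φ    = ∀ t → T t → ¬ (single t ⊨ φ)
T ⊨ φ ∧ᴸ ψ   = (T ⊨ φ) × (T ⊨ ψ)
T ⊨ φ ∨ᴸ ψ   = Σ Team λ S → Σ Team λ U → (T ≡∪ S , U) × (S ⊨ φ) × (U ⊨ ψ)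
T ⊨ Xᴸ φ     = (T ^ᵀ 1) ⊨ φ
T ⊨ Fᴸ φ     = Σ ℕ λ k → (T ^ᵀ k) ⊨ φ
T ⊨ Gᴸ φ     = ∀ k → (T ^ᵀ k) ⊨ φ
T ⊨ φ Uᴸ ψ   = Σ ℕ λ k → ((T ^ᵀ k) ⊨ ψ) × (∀ j → j < k → (T ^ᵀ j) ⊨ φ)
T ⊨ φ Rᴸ ψ   = ∀ k → ((T ^ᵀ k) ⊨ ψ) ⊎ (Σ ℕ λ j → j < k × ((T ^ᵀ j) ⊨ φ))
T ⊨ ∼ᴸ φ     = ¬ (T ⊨ φ)

Satisfiable : LTL → Set₁
Satisfiable φ = Σ Team λ T → T ⊨ φ

record Kripke : Set where
  field
    size   : ℕ
    R      : Fin size → Fin size → Bool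
    serial : ∀ w → Σ (Fin size) λ v → R w v ≡ true
    η      : Fin size → ℕ → Bool
    root   : Fin size

traces : Kripke → Team
traces K t =
  Σ (ℕ → Fin size) λ π →
    (π 0 ≡ root) × (∀ i → R (π i) (π (suc i)) ≡ true) × (∀ i p → t i p ≡ η (π i) p)
  where open Kripke K

FinSatisfiable : LTL → Set₁
FinSatisfiable φ = Σ Kripke λ K → traces K ⊨ φ

-- Third-order arithmetic, vocabulary (+, ×, 0, 1, =, ≤), well-scoped
-- (de Bruijn) syntax: n₁ / n₂ / n₃ free variables of order 1 / 2 / 3.

data Term (n₁ : ℕ) : Set where
  var  : Fin n₁ → Term n₁
  zeroᵗ oneᵗ : Term n₁
  _+ᵗ_ _×ᵗ_  : Term n₁ → Term n₁ → Term n₁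

data Form (n₁ n₂ n₃ : ℕ) : Set where
  _=ᶠ_ _≤ᶠ_ : Term n₁ → Term n₁ → Form n₁ n₂ n₃
  _∈₁_      : Term n₁ → Fin n₂ → Form n₁ n₂ n₃
  _∈₂_      : Fin n₂ → Fin n₃ → Form n₁ n₂ n₃
  ¬ᶠ        : Form n₁ n₂ n₃ → Form n₁ n₂ n₃
  _∧ᶠ_ _∨ᶠ_ : Form n₁ n₂ n₃ → Form n₁ n₂ n₃ → Form n₁ n₂ n₃
  ∃₁ ∀₁     : Form (suc n₁) n₂ n₃ → Form n₁ n₂ n₃
  ∃₂ ∀₂     : Form n₁ (suc n₂) n₃ → Form n₁ n₂ n₃
  ∃₃ ∀₃     : Form n₁ n₂ (suc n₃) → Form n₁ n₂ n₃

Sentence : Set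
Sentence = Form 0 0 0

NSet NSet2 : Set
NSet = ℕ → Bool
NSet2 = NSet → Bool

extend : ∀ {A : Set} {n} → A → (Fin n → A) → Fin (suc n) → A
extend a ρ fz     = a
extend a ρ (fs i) = ρ i

⟦_⟧ᵗ : ∀ {n₁} → Term n₁ → (Fin n₁ → ℕ) → ℕ
⟦ var i ⟧ᵗ ρ   = ρ i
⟦ zeroᵗ ⟧ᵗ ρ   = 0
⟦ oneᵗ ⟧ᵗ ρ    = 1
⟦ s +ᵗ u ⟧ᵗ ρ  = ⟦ s ⟧ᵗ ρ + ⟦ u ⟧ᵗ ρ
⟦ s ×ᵗ u ⟧ᵗ ρ  = ⟦ s ⟧ᵗ ρ * ⟦ u ⟧ᵗ ρ

Holds : ∀ {n₁ n₂ n₃} → Form n₁ n₂ n₃ →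
        (Fin n₁ → ℕ) → (Fin n₂ → NSet) → (Fin n₃ → NSet2) → Set
Holds (s =ᶠ u) ρ σ τ = ⟦ s ⟧ᵗ ρ ≡ ⟦ u ⟧ᵗ ρ
Holds (s ≤ᶠ u) ρ σ τ = ⟦ s ⟧ᵗ ρ ≤ ⟦ u ⟧ᵗ ρ
Holds (s ∈₁ X) ρ σ τ = σ X (⟦ s ⟧ᵗ ρ) ≡ true
Holds (X ∈₂ Y) ρ σ τ = τ Y (σ X) ≡ true
Holds (¬ᶠ φ) ρ σ τ   = ¬ Holds φ ρ σ τ
Holds (φ ∧ᶠ ψ) ρ σ τ = Holds φ ρ σ τ × Holds ψ ρ σ τ
Holds (φ ∨ᶠ ψ) ρ σ τ = Holds φ ρ σ τ ⊎ Holds ψ ρ σ τ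
Holds (∃₁ φ) ρ σ τ   = Σ ℕ λ a → Holds φ (extend a ρ) σ τ
Holds (∀₁ φ) ρ σ τ   = ∀ a → Holds φ (extend a ρ) σ τ
Holds (∃₂ φ) ρ σ τ   = Σ NSet λ A → Holds φ ρ (extend A σ) τ
Holds (∀₂ φ) ρ σ τ   = ∀ A → Holds φ ρ (extend A σ) τ
Holds (∃₃ φ) ρ σ τ   = Σ NSet2 λ A → Holds φ ρ σ (extend A τ)
Holds (∀₃ φ) ρ σ τ   = ∀ A → Holds φ ρ σ (extend A τ)

TrueInℕ : Sentence → Set
TrueInℕ θ = Holds θ (λ ()) (λ ()) (λ ())

-- String encodings (Polish notation; numbers in bijective base 2)

bdigits : B.ℕᵇ → List Bool
bdigits B.zero     = []
bdigits B.2[1+ x ] = true ∷ bdigits x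
bdigits B.1+[2 x ] = false ∷ bdigits x

encNum : ∀ {k} → Fin k → Fin k → Fin k → ℕ → List (Fin k)
encNum d1 d2 e n = map (λ b → if b then d2 else d1) (bdigits (B.fromℕ n)) ++ [ e ]

ΣL : ℕ
ΣL = 13

encLTL : LTL → List (Fin ΣL)
encLTL (prop p) = # 0 ∷ encNum (# 1) (# 2) (# 3) p
encLTL (neg φ)  = # 4 ∷ encLTL φ
encLTL (φ ∧ᴸ ψ) = # 5 ∷ encLTL φ ++ encLTL ψ
encLTL (φ ∨ᴸ ψ) = # 6 ∷ encLTL φ ++ encLTL ψ
encLTL (Xᴸ φ)   = # 7 ∷ encLTL φ
encLTL (Fᴸ φ)   = # 8 ∷ encLTL φ
encLTL (Gᴸ φ)   = # 9 ∷ encLTL φ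
encLTL (φ Uᴸ ψ) = # 10 ∷ encLTL φ ++ encLTL ψ
encLTL (φ Rᴸ ψ) = # 11 ∷ encLTL φ ++ encLTL ψ
encLTL (∼ᴸ φ)   = # 12 ∷ encLTL φ

ΣA : ℕ
ΣA = 21

encIdx : ℕ → List (Fin ΣA)
encIdx = encNum (# 0) (# 1) (# 2)

encTerm : ∀ {n₁} → Term n₁ → List (Fin ΣA)
encTerm (var i)  = # 3 ∷ encIdx (toℕ i)
encTerm zeroᵗ    = # 4 ∷ []
encTerm oneᵗ     = # 5 ∷ []
encTerm (s +ᵗ u) = # 6 ∷ encTerm s ++ encTerm u
encTerm (s ×ᵗ u) = # 7 ∷ encTerm s ++ encTerm u

encForm : ∀ {n₁ n₂ n₃} → Form n₁ n₂ n₃ → List (Fin ΣA)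
encForm (s =ᶠ u) = # 8 ∷ encTerm s ++ encTerm u
encForm (s ≤ᶠ u) = # 9 ∷ encTerm s ++ encTerm u
encForm (s ∈₁ X) = # 10 ∷ encTerm s ++ encIdx (toℕ X)
encForm (X ∈₂ Y) = # 11 ∷ encIdx (toℕ X) ++ encIdx (toℕ Y)
encForm (¬ᶠ φ)   = # 12 ∷ encForm φ
encForm (φ ∧ᶠ ψ) = # 13 ∷ encForm φ ++ encForm ψ
encForm (φ ∨ᶠ ψ) = # 14 ∷ encForm φ ++ encForm ψ
encForm (∃₁ φ)   = # 15 ∷ encForm φ
encForm (∀₁ φ)   = # 16 ∷ encForm φ
encForm (∃₂ φ)   = # 17 ∷ encForm φ
encForm (∀₂ φ)   = # 18 ∷ encForm φ
encForm (∃₃ φ)   = # 19 ∷ encForm φ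
encForm (∀₃ φ)   = # 20 ∷ encForm φ

SATLang : List (Fin ΣL) → Set₁
SATLang w = Σ LTL λ φ → (encLTL φ ≡ w) × Satisfiable φ

FinSATLang : List (Fin ΣL) → Set₁
FinSATLang w = Σ LTL λ φ → (encLTL φ ≡ w) × FinSatisfiable φ

Δ³₀Lang : List (Fin ΣA) → Set
Δ³₀Lang w = Σ Sentence λ θ → (encForm θ ≡ w) × TrueInℕ θ

-- Logspace transducers: read-only input tape with endmarkers, one
-- work tape, write-only output tape.

data Move : Set where
  left stay right : Move

record Transducer (a b : ℕ) : Set where
  field
    Q      : ℕ
    Γ      : ℕ
    start  : Fin Q
    halted : Fin Q → Bool
    blank  : Fin Γ
    -- input symbol (nothing = endmarker), work symbol  ↦
    -- new state, input move, written work symbol, work move, output symbol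
    δ : Fin Q → Maybe (Fin a) → Fin Γ →
        Fin Q × Move × Fin Γ × Move × Maybe (Fin b)

record Config {a b} (M : Transducer a b) : Set where
  constructor config
  open Transducer M
  field
    state : Fin Q
    ipos  : ℕ                 -- 0 and |w|+1 are the endmarkers
    tape  : ℕ → Fin Γ
    wpos  : ℕ
    out   : List (Fin b)

lookupL : ∀ {A : Set} → List A → ℕ → Maybe A
lookupL []       _       = nothing
lookupL (x ∷ xs) zero    = just x
lookupL (x ∷ xs) (suc i) = lookupL xs i

readInput : ∀ {a} → List (Fin a) → ℕ → Maybe (Fin a)
readInput w zero    = nothing
readInput w (suc i) = lookupL w i

moveHead : Move → ℕ → ℕ → ℕ
moveHead left  bound zero    = zero
moveHead left  bound (suc i) = i
moveHead stay  bound i       = i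
moveHead right bound i       = if i ≡ᵇ bound then i else suc i

-- bound for the work head: unbounded (space is bounded separately)
moveWork : Move → ℕ → ℕ
moveWork left  zero    = zero
moveWork left  (suc i) = i
moveWork stay  i       = i
moveWork right i       = suc i

update : ∀ {A : Set} → (ℕ → A) → ℕ → A → ℕ → A
update f i x j = if j ≡ᵇ i then x else f j

outSym : ∀ {b} → Maybe (Fin b) → List (Fin b)
outSym nothing  = []
outSym (just y) = [ y ]

step : ∀ {a b} (M : Transducer a b) → List (Fin a) → Config M → Config M
step M w c with Transducer.halted M (Config.state c)
... | true  = c
... | false with Transducer.δ M (Config.state c) (readInput w (Config.ipos c))
                  (Config.tape c (Config.wpos c))
... | (q , mi , g , mw , o) =
  config q (moveHead mi (suc (length w)) (Config.ipos c))
           (update (Config.tape c) (Config.wpos c) g)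
           (moveWork mw (Config.wpos c))
           (Config.out c ++ outSym o)

initial : ∀ {a b} (M : Transducer a b) → Config M
initial M = config (Transducer.start M) 0 (λ _ → Transducer.blank M) 0 []

run : ∀ {a b} (M : Transducer a b) → List (Fin a) → ℕ → Config M
run M w zero    = initial M
run M w (suc n) = step M w (run M w n)

LogspaceComputable : ∀ {a b} → (List (Fin a) → List (Fin b)) → Set
LogspaceComputable {a} {b} f =
  Σ (Transducer a b) λ M → Σ ℕ λ c → ∀ w →
    (Σ ℕ λ n → (Transducer.halted M (Config.state (run M w n)) ≡ true)
               × (Config.out (run M w n) ≡ f w))
    × (∀ m → Config.wpos (run M w m) < c * suc ⌊log₂ (suc (length w)) ⌋)

LogspaceReducible : ∀ {ℓ₁ ℓ₂ a b} →
  (List (Fin a) → Set ℓ₁) → (List (Fin b) → Set ℓ₂) → Set (ℓ₁ ⊔ ℓ₂)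
LogspaceReducible {a = a} {b = b} A B =
  Σ (List (Fin a) → List (Fin b)) λ f →
    LogspaceComputable f × (∀ w → A w ⇔ B (f w))

-- A trace t is coded by the set of numbers pair i p = (i + p)² + i with p ∈ t(i),
-- a team by a set of such codes, so φ can be translated into a third-order
-- formula tr φ about a team variable by following the team semantics clause
-- by clause: splitting a team quantifies over two sets of codes, T^k and
-- singleton teams are defined by comprehension.  Under excluded middle every
-- team is coded, up to pointwise equality of traces, under which team
-- semantics is invariant; so φ is satisfiable iff ∃T. tr φ is true, and
-- finitely satisfiable iff ∃T. (T is the team of a finite Kripke structure ∧
-- tr φ) is true.  In Polish notation the encoding of tr φ is the
-- concatenation of fixed blocks, one per symbol of φ, so the reduction is a
-- letter-to-word homomorphism, computable with constant work space; unique
-- readability of both encodings shows that no other input string is mapped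
-- to the encoding of a sentence.

module Submission where

open import Defs
open import Level using (Lift; lift; lower; 0ℓ) renaming (suc to lsuc)
open import Axiom.ExcludedMiddle using (ExcludedMiddle)
open import Data.Bool using (Bool; true; false; T; _≟_; if_then_else_)
open import Data.Bool.Properties using (⇔→≡)
open import Data.Empty using (⊥; ⊥-elim)
open import Data.Fin using (Fin; toℕ; fromℕ<; #_) renaming (zero to fz; suc to fs)
open import Data.Fin.Properties using (toℕ-injective; toℕ<n; toℕ-fromℕ<; all?)
open import Data.List using (List; []; _∷_; _++_; [_]; map; length; drop; concatMap)
open import Data.List.Properties using (++-assoc; ++-identityʳ; length-++; length-++-≤ʳ; ∷-injectiveʳ; concatMap-++)
open import Data.Maybe using (Maybe; just; nothing)
open import Data.Nat using (ℕ; zero; suc; _+_; _*_; _≤_; _<_; _≡ᵇ_; z≤n; s≤s; _<?_; _≤?_)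
open import Data.Nat.Properties
  using (≤-reflexive; ≤-trans; <-irrefl; <-cmp; +-comm; +-monoʳ-≤; +-cancelˡ-≡; *-suc; *-mono-≤
        ; *-distribˡ-+; m≤m+n; m≤n+m; m<m+n; m⊓n≤m; m≥n⇒m⊓n≡n; ≡ᵇ⇒≡; ≤-refl; module ≤-Reasoning)
open import Relation.Binary.Definitions using (tri<; tri≈; tri>)
import Data.Nat.Binary as Bin
import Data.Nat.Binary.Properties as Bin
open import Data.Product using (Σ; _×_; _,_; proj₁; proj₂)
open import Data.Sum using (_⊎_; inj₁; inj₂; [_,_]′; map₁) renaming (map to ⊎-map)
open import Function.Base using (_∘_)
open import Function.Bundles using (_⇔_; mk⇔; Equivalence)
open import Function.Properties.Equivalence using () renaming (trans to ⇔-trans; sym to ⇔-sym)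
open import Relation.Nullary using (¬_; Dec; yes; no)
open import Relation.Nullary.Decidable using (map′; does; dec-true; decidable-stable; from-yes)
open import Relation.Binary.PropositionalEquality hiding ([_])

module Classical (em : ExcludedMiddle (lsuc 0ℓ)) where

  dec : (P : Set) → Dec P
  dec P = map′ lower lift em

  stable : {P : Set} → ¬ ¬ P → P
  stable = decidable-stable (dec _)

  χ : Set → Bool
  χ P = does (dec P)

  χ-true : (P : Set) → χ P ≡ true ⇔ P
  χ-true P = mk⇔ (does-true (dec P)) (dec-true (dec P))
    where
    does-true : (d : Dec P) → does d ≡ true → P
    does-true (yes p) _ = p

pair : ℕ → ℕ → ℕ
pair i p = (i + p) * (i + p) + i

square+-< : ∀ s a s′ a′ → a ≤ s → s < s′ → s * s + a < s′ * s′ + a′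
square+-< s a s′ a′ a≤s s<s′ = begin-strict
  s * s + a               ≤⟨ +-monoʳ-≤ (s * s) a≤s ⟩
  s * s + s               <⟨ s≤s (≤-reflexive (+-comm (s * s) s)) ⟩
  suc (s + s * s)         ≤⟨ s≤s (m≤n+m (s + s * s) s) ⟩
  suc (s + (s + s * s))   ≡⟨ cong (λ x → suc (s + x)) (sym (*-suc s s)) ⟩
  suc s * suc s           ≤⟨ *-mono-≤ s<s′ s<s′ ⟩
  s′ * s′                 ≤⟨ m≤m+n (s′ * s′) a′ ⟩
  s′ * s′ + a′            ∎
  where open ≤-Reasoning

square+-injective : ∀ s a s′ a′ → a ≤ s → a′ ≤ s′ → s * s + a ≡ s′ * s′ + a′ → s ≡ s′
square+-injective s a s′ a′ a≤s a′≤s′ eq with <-cmp s s′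
... | tri≈ _ s≡s′ _ = s≡s′
... | tri< s<s′ _ _ = ⊥-elim (<-irrefl eq (square+-< s a s′ a′ a≤s s<s′))
... | tri> _ _ s′<s = ⊥-elim (<-irrefl (sym eq) (square+-< s′ a′ s a a′≤s′ s′<s))

pair-injective : ∀ {i p i′ p′} → pair i p ≡ pair i′ p′ → i ≡ i′ × p ≡ p′
pair-injective {i} {p} {i′} {p′} eq = i≡i′ , p≡p′
  where
  sums : i + p ≡ i′ + p′
  sums = square+-injective (i + p) i (i′ + p′) i′ (m≤m+n i p) (m≤m+n i′ p′) eq
  i≡i′ : i ≡ i′
  i≡i′ = +-cancelˡ-≡ ((i + p) * (i + p)) i i′ (trans eq (cong (λ x → x * x + i′) (sym sums)))
  p≡p′ : p ≡ p′
  p≡p′ = +-cancelˡ-≡ i p p′ (trans sums (cong (_+ p′) (sym i≡i′)))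

-- Team semantics up to pointwise equality of traces

≈ₜ-refl : ∀ {t} → t ≈ₜ t
≈ₜ-refl i p = refl

≈ₜ-sym : ∀ {t u} → t ≈ₜ u → u ≈ₜ t
≈ₜ-sym e i p = sym (e i p)

≈ₜ-trans : ∀ {t u v} → t ≈ₜ u → u ≈ₜ v → t ≈ₜ v
≈ₜ-trans e f i p = trans (e i p) (f i p)

_⊑ᵀ_ : Team → Team → Set
T ⊑ᵀ T′ = ∀ t → T t → Σ Trace λ t′ → T′ t′ × t ≈ₜ t′

_≃ᵀ_ : Team → Team → Set
T ≃ᵀ T′ = T ⊑ᵀ T′ × T′ ⊑ᵀ T

≃ᵀ-sym : ∀ {T T′} → T ≃ᵀ T′ → T′ ≃ᵀ T
≃ᵀ-sym (T⊑T′ , T′⊑T) = T′⊑T , T⊑T′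

⇔⇒≃ᵀ : ∀ {T T′} → (∀ t → T t ⇔ T′ t) → T ≃ᵀ T′
⇔⇒≃ᵀ T⇔T′ = (λ t x → t , Equivalence.to (T⇔T′ t) x , ≈ₜ-refl)
           , (λ t x → t , Equivalence.from (T⇔T′ t) x , ≈ₜ-refl)

single-≃ᵀ : ∀ {t t′} → t ≈ₜ t′ → single t ≃ᵀ single t′
single-≃ᵀ e = (λ u u≈t → u , ≈ₜ-trans u≈t e , ≈ₜ-refl)
            , (λ u u≈t′ → u , ≈ₜ-trans u≈t′ (≈ₜ-sym e) , ≈ₜ-refl)

^ᵀ-⊑ᵀ : ∀ {T T′} k → T ⊑ᵀ T′ → (T ^ᵀ k) ⊑ᵀ (T′ ^ᵀ k)
^ᵀ-⊑ᵀ k T⊑T′ u (t , Tt , e) =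
  let (t′ , T′t′ , t≈t′) = T⊑T′ t Tt
  in u , (t′ , T′t′ , λ i p → trans (sym (t≈t′ (k + i) p)) (e i p)) , ≈ₜ-refl

^ᵀ-≃ᵀ : ∀ {T T′} k → T ≃ᵀ T′ → (T ^ᵀ k) ≃ᵀ (T′ ^ᵀ k)
^ᵀ-≃ᵀ k (T⊑T′ , T′⊑T) = ^ᵀ-⊑ᵀ k T⊑T′ , ^ᵀ-⊑ᵀ k T′⊑T

⊨-≃ᵀ : ∀ φ {T T′} → T ≃ᵀ T′ → T ⊨ φ → T′ ⊨ φ
⊨-≃ᵀ (prop p) (_ , T′⊑T) T⊨p t′ T′t′ =
  let (t , Tt , t′≈t) = T′⊑T t′ T′t′ in lift (trans (t′≈t 0 p) (lower (T⊨p t Tt)))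
⊨-≃ᵀ (neg φ) (_ , T′⊑T) T⊨¬φ t′ T′t′ t′⊨φ =
  let (t , Tt , t′≈t) = T′⊑T t′ T′t′ in T⊨¬φ t Tt (⊨-≃ᵀ φ (single-≃ᵀ t′≈t) t′⊨φ)
⊨-≃ᵀ (φ ∧ᴸ ψ) T≃T′ (T⊨φ , T⊨ψ) = ⊨-≃ᵀ φ T≃T′ T⊨φ , ⊨-≃ᵀ ψ T≃T′ T⊨ψ
⊨-≃ᵀ (φ ∨ᴸ ψ) {T} {T′} (T⊑T′ , T′⊑T) (S , U , T≡S∪U , S⊨φ , U⊨ψ) =
  restrict S , restrict U , T′≡S′∪U′ , ⊨-≃ᵀ φ (part inj₁) S⊨φ , ⊨-≃ᵀ ψ (part inj₂) U⊨ψ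
  where
  restrict : Team → Team
  restrict V t′ = T′ t′ × Σ Trace λ t → V t × t ≈ₜ t′
  T′≡S′∪U′ : T′ ≡∪ restrict S , restrict U
  T′≡S′∪U′ t′ = mk⇔ split λ { (inj₁ (x , _)) → x ; (inj₂ (x , _)) → x }
    where
    split : T′ t′ → restrict S t′ ⊎ restrict U t′
    split x with T′⊑T t′ x
    ... | t , Tt , t′≈t with Equivalence.to (T≡S∪U t) Tt
    ... | inj₁ St = inj₁ (x , t , St , ≈ₜ-sym t′≈t)
    ... | inj₂ Ut = inj₂ (x , t , Ut , ≈ₜ-sym t′≈t)
  part : ∀ {V} → (∀ {t} → V t → S t ⊎ U t) → V ≃ᵀ restrict V
  part into = (λ t Vt → let (t′ , T′t′ , t≈t′) = T⊑T′ t (Equivalence.from (T≡S∪U t) (into Vt))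
                        in t′ , (T′t′ , t , Vt , t≈t′) , t≈t′)
            , (λ t′ (_ , t , Vt , t≈t′) → t , Vt , ≈ₜ-sym t≈t′)
⊨-≃ᵀ (Xᴸ φ) T≃T′ h = ⊨-≃ᵀ φ (^ᵀ-≃ᵀ 1 T≃T′) h
⊨-≃ᵀ (Fᴸ φ) T≃T′ (k , h) = k , ⊨-≃ᵀ φ (^ᵀ-≃ᵀ k T≃T′) h
⊨-≃ᵀ (Gᴸ φ) T≃T′ h k = ⊨-≃ᵀ φ (^ᵀ-≃ᵀ k T≃T′) (h k)
⊨-≃ᵀ (φ Uᴸ ψ) T≃T′ (k , h , before) =
  k , ⊨-≃ᵀ ψ (^ᵀ-≃ᵀ k T≃T′) h , λ j j<k → ⊨-≃ᵀ φ (^ᵀ-≃ᵀ j T≃T′) (before j j<k)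
⊨-≃ᵀ (φ Rᴸ ψ) T≃T′ h k with h k
... | inj₁ x = inj₁ (⊨-≃ᵀ ψ (^ᵀ-≃ᵀ k T≃T′) x)
... | inj₂ (j , j<k , x) = inj₂ (j , j<k , ⊨-≃ᵀ φ (^ᵀ-≃ᵀ j T≃T′) x)
⊨-≃ᵀ (∼ᴸ φ) T≃T′ T⊭φ T′⊨φ = T⊭φ (⊨-≃ᵀ φ (≃ᵀ-sym T≃T′) T′⊨φ)

∪-⊑ᵀ : ∀ {T S U} → T ≡∪ S , U → S ⊑ᵀ T × U ⊑ᵀ T
∪-⊑ᵀ T≡S∪U = (λ s Ss → s , Equivalence.from (T≡S∪U s) (inj₁ Ss) , ≈ₜ-refl)
            , (λ u Uu → u , Equivalence.from (T≡S∪U u) (inj₂ Uu) , ≈ₜ-refl)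

-- The translation into third-order arithmetic

pattern i₀ = fz
pattern i₁ = fs i₀
pattern i₂ = fs i₁
pattern i₃ = fs i₂

infixr 6 _⇒ᶠ_ _⇔ᶠ_

_⇒ᶠ_ : ∀ {a b c} → Form a b c → Form a b c → Form a b c
θ ⇒ᶠ θ′ = ¬ᶠ (θ ∧ᶠ ¬ᶠ θ′)

_⇔ᶠ_ : ∀ {a b c} → Form a b c → Form a b c → Form a b c
θ ⇔ᶠ θ′ = (θ ⇒ᶠ θ′) ∧ᶠ (θ′ ⇒ᶠ θ)

pairᵗ : ∀ {n} → Term n → Term n → Term n
pairᵗ s u = ((s +ᵗ u) ×ᵗ (s +ᵗ u)) +ᵗ s

twoᵗ : ∀ {n} → Term n
twoᵗ = oneᵗ +ᵗ oneᵗ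

digitᵗ : ∀ {n} → Bool → Term n
digitᵗ false = oneᵗ
digitᵗ true  = twoᵗ

-- bijective base 2, in the digit order of bdigits
numeralᵗ : ∀ {n} → List Bool → Term n
numeralᵗ []       = zeroᵗ
numeralᵗ (d ∷ ds) = digitᵗ d +ᵗ (twoᵗ ×ᵗ numeralᵗ ds)

numeralᵗ-bdigits : ∀ {n} (x : Bin.ℕᵇ) (ρ : Fin n → ℕ) → ⟦ numeralᵗ (bdigits x) ⟧ᵗ ρ ≡ Bin.toℕ x
numeralᵗ-bdigits Bin.zero     ρ = refl
numeralᵗ-bdigits Bin.2[1+ x ] ρ rewrite numeralᵗ-bdigits x ρ = sym (*-distribˡ-+ 2 1 (Bin.toℕ x))
numeralᵗ-bdigits Bin.1+[2 x ] ρ rewrite numeralᵗ-bdigits x ρ = refl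

numeralᵗ-ℕ : ∀ {n} (p : ℕ) (ρ : Fin n → ℕ) → ⟦ numeralᵗ (bdigits (Bin.fromℕ p)) ⟧ᵗ ρ ≡ p
numeralᵗ-ℕ p ρ = trans (numeralᵗ-bdigits (Bin.fromℕ p) ρ) (Bin.toℕ-fromℕ p)

-- A set of numbers v codes the trace i ↦ {p ∣ pair i p ∈ v}, a set of such
-- sets codes a team.

comprehensionᶠ : ∀ {a b c} → Fin c → Form a (suc b) c → Form a b c
comprehensionᶠ X θ = ∀₂ ((i₀ ∈₂ X) ⇔ᶠ θ)

sameTraceᶠ : ∀ {a b c} → Fin b → Fin b → Form a b c
sameTraceᶠ X Y = ∀₁ (∀₁ ((pairᵗ (var i₁) (var i₀) ∈₁ X) ⇔ᶠ (pairᵗ (var i₁) (var i₀) ∈₁ Y)))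

shiftedTraceᶠ : ∀ {a b c} → Term (suc (suc a)) → Fin b → Fin b → Form a b c
shiftedTraceᶠ k X Y =
  ∀₁ (∀₁ ((pairᵗ (k +ᵗ var i₁) (var i₀) ∈₁ X) ⇔ᶠ (pairᵗ (var i₁) (var i₀) ∈₁ Y)))

shiftᶠ : ∀ {a b c} → Term (suc (suc a)) → Fin c → Fin c → Form a b c
shiftᶠ k T S = comprehensionᶠ S (∃₂ ((i₀ ∈₂ T) ∧ᶠ shiftedTraceᶠ k i₀ i₁))

singletonᶠ : ∀ {a b c} → Fin b → Fin c → Form a b c
singletonᶠ u X = comprehensionᶠ X (sameTraceᶠ i₀ (fs u))

sameᶠ : ∀ {a b c} → Fin c → Fin c → Form a b c
sameᶠ X Y = comprehensionᶠ X (i₀ ∈₂ Y)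

unionᶠ : ∀ {a b c} → Fin c → Fin c → Fin c → Form a b c
unionᶠ T S U = comprehensionᶠ T ((i₀ ∈₂ S) ∨ᶠ (i₀ ∈₂ U))

Scope : Set
Scope = ℕ × ℕ × ℕ

Formula : Scope → Set
Formula (a , b , c) = Form a b c

-- A formula with a hole in its rightmost position; in Polish notation the
-- hole is then a suffix of the encoding.
infixr 5 ¬∙_ _∧∙_ _∨∙_ ∃₁∙_ ∀₁∙_ ∃₂∙_ ∀₂∙_ ∃₃∙_ ∀₃∙_

data Spine : Scope → Scope → Set where
  ∙         : ∀ {s} → Spine s s
  ¬∙_       : ∀ {a b c t} → Spine (a , b , c) t → Spine (a , b , c) t
  _∧∙_ _∨∙_ : ∀ {a b c t} → Form a b c → Spine (a , b , c) t → Spine (a , b , c) t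
  ∃₁∙_ ∀₁∙_ : ∀ {a b c t} → Spine (suc a , b , c) t → Spine (a , b , c) t
  ∃₂∙_ ∀₂∙_ : ∀ {a b c t} → Spine (a , suc b , c) t → Spine (a , b , c) t
  ∃₃∙_ ∀₃∙_ : ∀ {a b c t} → Spine (a , b , suc c) t → Spine (a , b , c) t

plug : ∀ {s t} → Spine s t → Formula t → Formula s
plug ∙        θ = θ
plug (¬∙ C)   θ = ¬ᶠ (plug C θ)
plug (ξ ∧∙ C) θ = ξ ∧ᶠ plug C θ
plug (ξ ∨∙ C) θ = ξ ∨ᶠ plug C θ
plug (∃₁∙ C)  θ = ∃₁ (plug C θ)
plug (∀₁∙ C)  θ = ∀₁ (plug C θ)
plug (∃₂∙ C)  θ = ∃₂ (plug C θ)
plug (∀₂∙ C)  θ = ∀₂ (plug C θ)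
plug (∃₃∙ C)  θ = ∃₃ (plug C θ)
plug (∀₃∙ C)  θ = ∀₃ (plug C θ)

data Connective : Set where
  ∧ᶜ ∨ᶜ : Connective

connect : ∀ {a b c} → Connective → Form a b c → Form a b c → Form a b c
connect ∧ᶜ = _∧ᶠ_
connect ∨ᶜ = _∨ᶠ_

plug₂ : ∀ {a b c a′ b′ c′ t} → Spine (a , b , c) (a′ , b′ , c′) → Connective →
        Spine (a′ , b′ , c′) t → Formula t → Form a′ b′ c′ → Form a b c
plug₂ C κ D θ θ′ = plug C (connect κ (plug D θ) θ′)

-- ∃ S. S = T^k ∧ □, the new team S being variable 0 of the third order
atShift : ∀ {a b c} → Term (suc (suc a)) → Fin c → Spine (a , b , c) (a , b , suc c)
atShift k T = ∃₃∙ shiftᶠ k (fs T) i₀ ∧∙ ∙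

propSpine : ∀ {a b c} → Spine (a , b , suc c) (suc a , suc b , suc c)
propSpine = ∀₂∙ ¬ᶠ (i₀ ∈₂ i₀) ∨∙ ∃₁∙ (pairᵗ zeroᵗ (var i₀) ∈₁ i₀) ∧∙ ∙

negSpine : ∀ {a b c} → Spine (a , b , suc c) (a , suc b , suc (suc c))
negSpine = ∀₂∙ ¬ᶠ (i₀ ∈₂ i₀) ∨∙ ∃₃∙ singletonᶠ i₀ i₀ ∧∙ ¬∙ ∙

splitSpine : ∀ {a b c} → Spine (a , b , suc c) (a , b , suc (suc (suc c)))
splitSpine = ∃₃∙ ∃₃∙ unionᶠ i₂ i₁ i₀ ∧∙ ∙

copySpine : ∀ {a b c} → Spine (a , b , suc (suc (suc c))) (a , b , suc (suc (suc (suc c))))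
copySpine = ∃₃∙ sameᶠ i₀ i₂ ∧∙ ∙

nextSpine : ∀ {a b c} → Spine (a , b , suc c) (a , b , suc (suc c))
nextSpine = atShift oneᵗ i₀

someShiftSpine everyShiftSpine : ∀ {a b c} → Spine (a , b , suc c) (suc a , b , suc (suc c))
someShiftSpine  = ∃₁∙ atShift (var i₂) i₀
everyShiftSpine = ∀₁∙ atShift (var i₂) i₀

-- the hole sees the shift by j of the team one level up, j ranging below k
everyEarlierSpine someEarlierSpine : ∀ {a b c} →
  Spine (suc a , b , suc (suc c)) (suc (suc a) , b , suc (suc (suc c)))
everyEarlierSpine = ∀₁∙ ¬ᶠ ((oneᵗ +ᵗ var i₀) ≤ᶠ var i₁) ∨∙ atShift (var i₂) i₁
someEarlierSpine  = ∃₁∙ ((oneᵗ +ᵗ var i₀) ≤ᶠ var i₁) ∧∙ atShift (var i₂) i₁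

tr : ∀ {a b c} → LTL → Form a b (suc c)
tr (prop p)  = plug propSpine (var i₀ =ᶠ numeralᵗ (bdigits (Bin.fromℕ p)))
tr (neg φ)   = plug negSpine (tr φ)
tr (φ ∧ᴸ ψ)  = tr φ ∧ᶠ tr ψ
tr (φ ∨ᴸ ψ)  = plug₂ splitSpine ∧ᶜ copySpine (tr φ) (tr ψ)
tr (Xᴸ φ)    = plug nextSpine (tr φ)
tr (Fᴸ φ)    = plug someShiftSpine (tr φ)
tr (Gᴸ φ)    = plug everyShiftSpine (tr φ)
tr (φ Uᴸ ψ)  = plug₂ someShiftSpine ∧ᶜ everyEarlierSpine (tr φ) (tr ψ)
tr (φ Rᴸ ψ)  = plug₂ everyShiftSpine ∨ᶜ someEarlierSpine (tr φ) (tr ψ)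
tr (∼ᴸ φ)    = ¬ᶠ (tr φ)

-- Correctness of the translation

∃-⇔ : ∀ {ℓ ℓ′} {A : Set} {P : A → Set ℓ} {Q : A → Set ℓ′} → (∀ x → P x ⇔ Q x) → Σ A P ⇔ Σ A Q
∃-⇔ P⇔Q = mk⇔ (λ (x , p) → x , Equivalence.to (P⇔Q x) p) (λ (x , q) → x , Equivalence.from (P⇔Q x) q)

∀-⇔ : ∀ {ℓ ℓ′} {A : Set} {P : A → Set ℓ} {Q : A → Set ℓ′} → (∀ x → P x ⇔ Q x) → (∀ x → P x) ⇔ (∀ x → Q x)
∀-⇔ P⇔Q = mk⇔ (λ p x → Equivalence.to (P⇔Q x) (p x)) (λ q x → Equivalence.from (P⇔Q x) (q x))

≡-⇔ : ∀ {A : Set} {x x′ y : A} → x ≡ x′ → (x ≡ y) ⇔ (x′ ≡ y)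
≡-⇔ x≡x′ = mk⇔ (trans (sym x≡x′)) (trans x≡x′)

decode : NSet → Trace
decode v i p = v (pair i p)

teamOf : NSet2 → Team
teamOf A t = Σ NSet λ v → (A v ≡ true) × decode v ≈ₜ t

ShiftOf : ℕ → NSet2 → NSet → Set
ShiftOf K A v = Σ NSet λ u → (A u ≡ true) × suffix K (decode u) ≈ₜ decode v

teamOf-singleton : ∀ X v → (∀ w → X w ≡ true ⇔ decode w ≈ₜ decode v) → teamOf X ≃ᵀ single (decode v)
teamOf-singleton X v X≡ = ⇔⇒≃ᵀ λ t → mk⇔
  (λ (w , Xw , w≈t) → ≈ₜ-trans (≈ₜ-sym w≈t) (Equivalence.to (X≡ w) Xw))
  (λ t≈v → v , Equivalence.from (X≡ v) ≈ₜ-refl , ≈ₜ-sym t≈v)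

teamOf-union : ∀ A S U → (∀ v → A v ≡ true ⇔ (S v ≡ true ⊎ U v ≡ true)) →
  teamOf A ≡∪ teamOf S , teamOf U
teamOf-union A S U A≡ t = mk⇔
  (λ (v , Av , v≈t) → ⊎-map (λ Sv → v , Sv , v≈t) (λ Uv → v , Uv , v≈t) (Equivalence.to (A≡ v) Av))
  λ { (inj₁ (v , Sv , v≈t)) → v , Equivalence.from (A≡ v) (inj₁ Sv) , v≈t
    ; (inj₂ (v , Uv , v≈t)) → v , Equivalence.from (A≡ v) (inj₂ Uv) , v≈t }

¬⊎⇔⇒ : ∀ {ℓ ℓ′} {A : Set ℓ} {B : Set ℓ′} → Dec A → (¬ A ⊎ B) ⇔ (A → B)
¬⊎⇔⇒ A? = mk⇔ (λ { (inj₁ ¬a) a → ⊥-elim (¬a a) ; (inj₂ b) _ → b }) (decide A?)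
  where
  decide : ∀ {A B} → Dec A → (A → B) → ¬ A ⊎ B
  decide (yes a) f = inj₂ (f a)
  decide (no ¬a) _ = inj₁ ¬a

Invariant : (Team → Set₁) → Set₁
Invariant Q = ∀ {T T′ : Team} → T ≃ᵀ T′ → Q T → Q T′

module Semantics (em : ExcludedMiddle (lsuc 0ℓ)) where
  open Classical em
  open Equivalence using (to; from)

  encode : Trace → NSet
  encode t z = χ (Σ ℕ λ i → Σ ℕ λ p → pair i p ≡ z × t i p ≡ true)

  decode-encode : ∀ t → decode (encode t) ≈ₜ t
  decode-encode t i p = ⇔→≡ (mk⇔ sound λ tip → from (χ-true _) (i , p , refl , tip))
    where
    sound : encode t (pair i p) ≡ true → t i p ≡ true
    sound e with to (χ-true _) e
    ... | i′ , p′ , eq , tip′ with pair-injective {i′} {p′} {i} {p} eq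
    ... | refl , refl = tip′

  teamOf-≃ᵀ : ∀ T → T ≃ᵀ teamOf (λ v → χ (Σ Trace λ t → T t × decode v ≈ₜ t))
  teamOf-≃ᵀ T =
      (λ t Tt → t , (encode t , from (χ-true _) (t , Tt , decode-encode t) , decode-encode t) , ≈ₜ-refl)
    , (λ t (v , Av , v≈t) → let (t′ , Tt′ , v≈t′) = to (χ-true _) Av in t′ , Tt′ , ≈ₜ-trans (≈ₜ-sym v≈t) v≈t′)

  teamOf-shift : ∀ K A S → (∀ v → S v ≡ true ⇔ ShiftOf K A v) → ∀ t → teamOf S t ⇔ (teamOf A ^ᵀ K) t
  teamOf-shift K A S S≡ t = mk⇔
    (λ (v , Sv , v≈t) → let (u , Au , sh) = to (S≡ v) Sv in
       decode u , (u , Au , ≈ₜ-refl) , ≈ₜ-trans sh v≈t)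
    (λ (t₀ , (u , Au , u≈t₀) , sh) →
       encode t , from (S≡ (encode t))
         (u , Au , λ i p → trans (u≈t₀ (K + i) p) (trans (sh i p) (sym (decode-encode t i p))))
       , decode-encode t)

  Holds-⇒ᶠ : ∀ {a b c} (θ θ′ : Form a b c) ρ σ τ →
    Holds (θ ⇒ᶠ θ′) ρ σ τ ⇔ (Holds θ ρ σ τ → Holds θ′ ρ σ τ)
  Holds-⇒ᶠ θ θ′ ρ σ τ = mk⇔ (λ h x → stable λ ¬y → h (x , ¬y)) (λ f (x , ¬y) → ¬y (f x))

  Holds-⇔ᶠ : ∀ {a b c} (θ θ′ : Form a b c) ρ σ τ →
    Holds (θ ⇔ᶠ θ′) ρ σ τ ⇔ (Holds θ ρ σ τ ⇔ Holds θ′ ρ σ τ)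
  Holds-⇔ᶠ θ θ′ ρ σ τ = mk⇔
    (λ (f , g) → mk⇔ (to (Holds-⇒ᶠ θ θ′ ρ σ τ) f) (to (Holds-⇒ᶠ θ′ θ ρ σ τ) g))
    (λ e → from (Holds-⇒ᶠ θ θ′ ρ σ τ) (to e) , from (Holds-⇒ᶠ θ′ θ ρ σ τ) (from e))

  Holds-∈₁⇔ᶠ∈₁ : ∀ {a b c} (s s′ : Term a) (X Y : Fin b) ρ σ (τ : Fin c → NSet2) →
    Holds ((s ∈₁ X) ⇔ᶠ (s′ ∈₁ Y)) ρ σ τ ⇔ (σ X (⟦ s ⟧ᵗ ρ) ≡ σ Y (⟦ s′ ⟧ᵗ ρ))
  Holds-∈₁⇔ᶠ∈₁ s s′ X Y ρ σ τ = mk⇔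
    (λ h → ⇔→≡ (to (Holds-⇔ᶠ (s ∈₁ X) (s′ ∈₁ Y) ρ σ τ) h))
    (λ e → from (Holds-⇔ᶠ (s ∈₁ X) (s′ ∈₁ Y) ρ σ τ) (≡-⇔ e))

  Holds-comprehension : ∀ {a b c} (X : Fin c) (θ : Form a (suc b) c) ρ σ τ →
    Holds (comprehensionᶠ X θ) ρ σ τ ⇔ (∀ v → τ X v ≡ true ⇔ Holds θ ρ (extend v σ) τ)
  Holds-comprehension X θ ρ σ τ = ∀-⇔ λ v → Holds-⇔ᶠ (i₀ ∈₂ X) θ ρ (extend v σ) τ

  comprehension-cong : ∀ {ℓ ℓ′} {P : NSet → Set ℓ} {Q : NSet → Set ℓ′} (X : NSet2) →
    (∀ v → P v ⇔ Q v) → (∀ v → X v ≡ true ⇔ P v) ⇔ (∀ v → X v ≡ true ⇔ Q v)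
  comprehension-cong X P⇔Q = ∀-⇔ λ v → mk⇔ (λ e → ⇔-trans e (P⇔Q v)) (λ e → ⇔-trans e (⇔-sym (P⇔Q v)))

  sameTraceᶠ-correct : ∀ {a b c} (X Y : Fin b) ρ σ τ →
    Holds {a} {b} {c} (sameTraceᶠ X Y) ρ σ τ ⇔ decode (σ X) ≈ₜ decode (σ Y)
  sameTraceᶠ-correct X Y ρ σ τ = ∀-⇔ λ i → ∀-⇔ λ p →
    Holds-∈₁⇔ᶠ∈₁ (pairᵗ (var i₁) (var i₀)) (pairᵗ (var i₁) (var i₀)) X Y (extend p (extend i ρ)) σ τ

  shiftedTraceᶠ-correct : ∀ {a b c} (k : Term (suc (suc a))) (X Y : Fin b) ρ σ τ K →
    (∀ i p → ⟦ k ⟧ᵗ (extend p (extend i ρ)) ≡ K) →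
    Holds {a} {b} {c} (shiftedTraceᶠ k X Y) ρ σ τ ⇔ suffix K (decode (σ X)) ≈ₜ decode (σ Y)
  shiftedTraceᶠ-correct k X Y ρ σ τ K k≡K = ∀-⇔ λ i → ∀-⇔ λ p →
    ⇔-trans (Holds-∈₁⇔ᶠ∈₁ (pairᵗ (k +ᵗ var i₁) (var i₀)) (pairᵗ (var i₁) (var i₀)) X Y
                          (extend p (extend i ρ)) σ τ)
            (≡-⇔ (cong (λ x → σ X (pair (x + i) p)) (k≡K i p)))

  sameᶠ-correct : ∀ {a b c} (X Y : Fin c) ρ σ τ →
    Holds {a} {b} (sameᶠ X Y) ρ σ τ ⇔ (∀ v → τ X v ≡ τ Y v)
  sameᶠ-correct X Y ρ σ τ = ⇔-trans (Holds-comprehension X (i₀ ∈₂ Y) ρ σ τ)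
    (∀-⇔ λ v → mk⇔ ⇔→≡ ≡-⇔)

  unionᶠ-correct : ∀ {a b c} (T S U : Fin c) ρ σ τ →
    Holds {a} {b} (unionᶠ T S U) ρ σ τ ⇔ (∀ v → τ T v ≡ true ⇔ (τ S v ≡ true ⊎ τ U v ≡ true))
  unionᶠ-correct T S U = Holds-comprehension T ((i₀ ∈₂ S) ∨ᶠ (i₀ ∈₂ U))

  singletonᶠ-correct : ∀ {a b c} (u : Fin b) (X : Fin c) ρ σ τ →
    Holds {a} (singletonᶠ u X) ρ σ τ ⇔ (∀ v → τ X v ≡ true ⇔ decode v ≈ₜ decode (σ u))
  singletonᶠ-correct u X ρ σ τ = ⇔-trans (Holds-comprehension X (sameTraceᶠ i₀ (fs u)) ρ σ τ)
    (comprehension-cong (τ X) λ v → sameTraceᶠ-correct i₀ (fs u) ρ (extend v σ) τ)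

  shiftᶠ-correct : ∀ {a b c} (k : Term (suc (suc a))) (T S : Fin c) ρ σ τ K →
    (∀ i p → ⟦ k ⟧ᵗ (extend p (extend i ρ)) ≡ K) →
    Holds {a} {b} (shiftᶠ k T S) ρ σ τ ⇔ (∀ v → τ S v ≡ true ⇔ ShiftOf K (τ T) v)
  shiftᶠ-correct {a} {b} {c} k T S ρ σ τ K k≡K =
    ⇔-trans (Holds-comprehension S (∃₂ ((i₀ ∈₂ T) ∧ᶠ shiftedTraceᶠ k i₀ i₁)) ρ σ τ)
      (comprehension-cong (τ S) λ v → ∃-⇔ λ u → mk⇔
        (λ (Tu , sh) → Tu , to (shifted v u) sh) (λ (Tu , sh) → Tu , from (shifted v u) sh))
    where
    shifted : ∀ v u → Holds {a} {suc (suc b)} {c} (shiftedTraceᶠ k i₀ i₁) ρ (extend u (extend v σ)) τ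
                        ⇔ suffix K (decode u) ≈ₜ decode v
    shifted v u = shiftedTraceᶠ-correct k i₀ i₁ ρ (extend u (extend v σ)) τ K k≡K

  atShift-correct : ∀ {a b c} (k : Term (suc (suc a))) (T : Fin c) ρ σ τ K →
    (∀ i p → ⟦ k ⟧ᵗ (extend p (extend i ρ)) ≡ K) →
    (θ : Form a b (suc c)) (Q : Team → Set₁) → Invariant Q →
    (∀ S → Holds θ ρ σ (extend S τ) ⇔ Q (teamOf S)) →
    Holds (plug (atShift k T) θ) ρ σ τ ⇔ Q (teamOf (τ T) ^ᵀ K)
  atShift-correct {a} {b} {c} k T ρ σ τ K k≡K θ Q Q-inv θ⇔Q = mk⇔
    (λ (S , sh , θS) → Q-inv (⇔⇒≃ᵀ (teamOf-shift K (τ T) S (to (shift S) sh))) (to (θ⇔Q S) θS))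
    (λ q → S₀ , from (shift S₀) S₀≡ ,
           from (θ⇔Q S₀) (Q-inv (≃ᵀ-sym (⇔⇒≃ᵀ (teamOf-shift K (τ T) S₀ S₀≡))) q))
    where
    shift : ∀ S → Holds {a} {b} (shiftᶠ k (fs T) i₀) ρ σ (extend S τ) ⇔ (∀ v → S v ≡ true ⇔ ShiftOf K (τ T) v)
    shift S = shiftᶠ-correct k (fs T) i₀ ρ σ (extend S τ) K k≡K
    S₀ : NSet2
    S₀ v = χ (ShiftOf K (τ T) v)
    S₀≡ : ∀ v → S₀ v ≡ true ⇔ ShiftOf K (τ T) v
    S₀≡ v = χ-true _

  -- restricted to A, as different codes may decode to the same trace
  subcode : NSet2 → Team → NSet2
  subcode A S v = χ ((A v ≡ true) × Σ Trace λ t → S t × decode v ≈ₜ t)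

  subcode-≃ᵀ : ∀ A S → S ⊑ᵀ teamOf A → S ≃ᵀ teamOf (subcode A S)
  subcode-≃ᵀ A S S⊑A =
      (λ s Ss → let (t , (v , Av , v≈t) , s≈t) = S⊑A s Ss in
                decode v , (v , from (χ-true _) (Av , s , Ss , ≈ₜ-trans v≈t (≈ₜ-sym s≈t)) , ≈ₜ-refl)
                         , ≈ₜ-trans s≈t (≈ₜ-sym v≈t))
    , (λ t (v , Sv , v≈t) → let (_ , s , Ss , v≈s) = to (χ-true _) Sv in
                            s , Ss , ≈ₜ-trans (≈ₜ-sym v≈t) v≈s)

  subcode-union : ∀ A S U → teamOf A ≡∪ S , U →
    ∀ v → A v ≡ true ⇔ (subcode A S v ≡ true ⊎ subcode A U v ≡ true)
  subcode-union A S U A≡S∪U v = mk⇔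
    (λ Av → ⊎-map (λ Ss → from (χ-true _) (Av , decode v , Ss , ≈ₜ-refl))
                         (λ Us → from (χ-true _) (Av , decode v , Us , ≈ₜ-refl))
                         (to (A≡S∪U (decode v)) (v , Av , ≈ₜ-refl)))
    λ { (inj₁ Sv) → proj₁ (to (χ-true _) Sv) ; (inj₂ Uv) → proj₁ (to (χ-true _) Uv) }

  mutual
    tr-correct : ∀ φ {a b c} ρ σ (τ : Fin (suc c) → NSet2) →
      Holds (tr {a} {b} φ) ρ σ τ ⇔ teamOf (τ i₀) ⊨ φ
    tr-correct (prop p) {a} ρ σ τ = mk⇔
      (λ h t (v , Av , v≈t) →
         lift (trans (sym (v≈t 0 p)) (at-p v (to (¬⊎⇔⇒ (τ i₀ v ≟ true)) (h v) Av))))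
      (λ h v → from (¬⊎⇔⇒ (τ i₀ v ≟ true)) λ Av →
         p , lower (h (decode v) (v , Av , ≈ₜ-refl)) , sym (numeralᵗ-ℕ p (extend p ρ)))
      where
      at-p : ∀ v → Σ ℕ (λ q → v (pair 0 q) ≡ true
                             × q ≡ ⟦ numeralᵗ {suc a} (bdigits (Bin.fromℕ p)) ⟧ᵗ (extend q ρ)) →
             v (pair 0 p) ≡ true
      at-p v (q , vq , q≡p) = subst (λ z → v (pair 0 z) ≡ true) (trans q≡p (numeralᵗ-ℕ p (extend q ρ))) vq
    tr-correct (neg φ) {a} {b} ρ σ τ = mk⇔
      (λ h t (v , Av , v≈t) t⊨φ →
         let (X , X≡ , X⊭φ) = to (¬⊎⇔⇒ (τ i₀ v ≟ true)) (h v) Av in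
         X⊭φ (from (tr-correct φ ρ (extend v σ) (extend X τ))
               (⊨-≃ᵀ φ (≃ᵀ-sym (teamOf-singleton X v (to (singleton v X) X≡)))
                 (⊨-≃ᵀ φ (single-≃ᵀ (≈ₜ-sym v≈t)) t⊨φ))))
      (λ h v → from (¬⊎⇔⇒ (τ i₀ v ≟ true)) λ Av →
         X₀ v , from (singleton v (X₀ v)) (λ _ → χ-true _) ,
         λ X₀⊨φ → h (decode v) (v , Av , ≈ₜ-refl)
           (⊨-≃ᵀ φ (teamOf-singleton (X₀ v) v (λ _ → χ-true _))
             (to (tr-correct φ ρ (extend v σ) (extend (X₀ v) τ)) X₀⊨φ)))
      where
      singleton : ∀ v X → Holds {a} (singletonᶠ i₀ i₀) ρ (extend v σ) (extend X τ)
                            ⇔ (∀ w → X w ≡ true ⇔ decode w ≈ₜ decode v)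
      singleton v X = singletonᶠ-correct i₀ i₀ ρ (extend v σ) (extend X τ)
      X₀ : NSet → NSet2
      X₀ v w = χ (decode w ≈ₜ decode v)
    tr-correct (φ ∧ᴸ ψ) ρ σ τ = mk⇔
      (λ (x , y) → to (tr-correct φ ρ σ τ) x , to (tr-correct ψ ρ σ τ) y)
      (λ (x , y) → from (tr-correct φ ρ σ τ) x , from (tr-correct ψ ρ σ τ) y)
    tr-correct (φ ∨ᴸ ψ) ρ σ τ = mk⇔
      (λ (S , U , ∪≡ , (X , X≡S , X⊨φ) , U⊨ψ) →
         let τ′ = extend U (extend S τ) in
         teamOf S , teamOf U ,
         teamOf-union (τ i₀) S U (to (unionᶠ-correct i₂ i₁ i₀ ρ σ τ′) ∪≡) ,
         ⊨-≃ᵀ φ (⇔⇒≃ᵀ λ t → same (to (sameᶠ-correct i₀ i₂ ρ σ (extend X τ′)) X≡S))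
               (to (tr-correct φ ρ σ (extend X τ′)) X⊨φ) ,
         to (tr-correct ψ ρ σ τ′) U⊨ψ)
      (λ (S , U , ∪≡ , S⊨φ , U⊨ψ) →
         let S₀ = subcode (τ i₀) S ; U₀ = subcode (τ i₀) U ; τ′ = extend U₀ (extend S₀ τ)
             (S⊑ , U⊑) = ∪-⊑ᵀ ∪≡ in
         S₀ , U₀ , from (unionᶠ-correct i₂ i₁ i₀ ρ σ τ′) (subcode-union (τ i₀) S U ∪≡) ,
         (S₀ , from (sameᶠ-correct i₀ i₂ ρ σ (extend S₀ τ′)) (λ _ → refl) ,
               from (tr-correct φ ρ σ (extend S₀ τ′)) (⊨-≃ᵀ φ (subcode-≃ᵀ (τ i₀) S S⊑) S⊨φ)) ,
         from (tr-correct ψ ρ σ τ′) (⊨-≃ᵀ ψ (subcode-≃ᵀ (τ i₀) U U⊑) U⊨ψ))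
      where
      same : ∀ {X S : NSet2} {t} → (∀ v → X v ≡ S v) → teamOf X t ⇔ teamOf S t
      same X≡S = mk⇔ (λ (v , Xv , v≈t) → v , trans (sym (X≡S v)) Xv , v≈t)
                     (λ (v , Sv , v≈t) → v , trans (X≡S v) Sv , v≈t)
    tr-correct (Xᴸ φ) ρ σ τ = atShift-tr φ oneᵗ i₀ ρ σ τ 1 (λ _ _ → refl)
    tr-correct (Fᴸ φ) ρ σ τ = ∃-⇔ λ K → atShift-tr φ (var i₂) i₀ (extend K ρ) σ τ K (λ _ _ → refl)
    tr-correct (Gᴸ φ) ρ σ τ = ∀-⇔ λ K → atShift-tr φ (var i₂) i₀ (extend K ρ) σ τ K (λ _ _ → refl)
    tr-correct (φ Uᴸ ψ) ρ σ τ = ∃-⇔ λ K →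
      atShift-correct (var i₂) i₀ (extend K ρ) σ τ K (λ _ _ → refl)
        (plug everyEarlierSpine (tr φ) ∧ᶠ tr ψ)
        (λ T → T ⊨ ψ × (∀ j → j < K → (teamOf (τ i₀) ^ᵀ j) ⊨ φ)) (λ T≃T′ (x , y) → ⊨-≃ᵀ ψ T≃T′ x , y)
        λ S → mk⇔ (λ (x , y) → to (tr-correct ψ (extend K ρ) σ (extend S τ)) y ,
                               to (everyEarlier-tr φ ρ σ (extend S τ) K) x)
                  (λ (y , x) → from (everyEarlier-tr φ ρ σ (extend S τ) K) x ,
                               from (tr-correct ψ (extend K ρ) σ (extend S τ)) y)
    tr-correct (φ Rᴸ ψ) ρ σ τ = ∀-⇔ λ K →
      atShift-correct (var i₂) i₀ (extend K ρ) σ τ K (λ _ _ → refl)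
        (plug someEarlierSpine (tr φ) ∨ᶠ tr ψ)
        (λ T → T ⊨ ψ ⊎ (Σ ℕ λ j → j < K × (teamOf (τ i₀) ^ᵀ j) ⊨ φ))
        (λ T≃T′ → map₁ (⊨-≃ᵀ ψ T≃T′))
        λ S → let ψ-sem = tr-correct ψ (extend K ρ) σ (extend S τ)
                  φ-sem = someEarlier-tr φ ρ σ (extend S τ) K in
              mk⇔ [ inj₂ ∘ to φ-sem , inj₁ ∘ to ψ-sem ]′
                  [ inj₂ ∘ from ψ-sem , inj₁ ∘ from φ-sem ]′
    tr-correct (∼ᴸ φ) ρ σ τ = mk⇔ (λ ¬h h → ¬h (from (tr-correct φ ρ σ τ) h))
                                  (λ ¬h h → ¬h (to (tr-correct φ ρ σ τ) h))

    atShift-tr : ∀ φ {a b c} (k : Term (suc (suc a))) (T : Fin c) ρ σ τ K →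
      (∀ i p → ⟦ k ⟧ᵗ (extend p (extend i ρ)) ≡ K) →
      Holds {a} {b} (plug (atShift k T) (tr φ)) ρ σ τ ⇔ (teamOf (τ T) ^ᵀ K) ⊨ φ
    atShift-tr φ k T ρ σ τ K k≡K =
      atShift-correct k T ρ σ τ K k≡K (tr φ) (_⊨ φ) (⊨-≃ᵀ φ) λ S → tr-correct φ ρ σ (extend S τ)

    everyEarlier-tr : ∀ φ {a b c} ρ σ (τ : Fin (suc (suc c)) → NSet2) K →
      Holds {suc a} {b} (plug everyEarlierSpine (tr φ)) (extend K ρ) σ τ
        ⇔ (∀ j → j < K → (teamOf (τ i₁) ^ᵀ j) ⊨ φ)
    everyEarlier-tr φ {a} {b} ρ σ τ K = ∀-⇔ λ j → ⇔-trans (¬⊎⇔⇒ (suc j ≤? K))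
      (mk⇔ (λ h j<K → to (shifted j) (h j<K)) (λ h j<K → from (shifted j) (h j<K)))
      where
      shifted : ∀ j → Holds {suc (suc a)} {b} (plug (atShift (var i₂) i₁) (tr φ)) (extend j (extend K ρ)) σ τ
                        ⇔ (teamOf (τ i₁) ^ᵀ j) ⊨ φ
      shifted j = atShift-tr φ (var i₂) i₁ (extend j (extend K ρ)) σ τ j (λ _ _ → refl)

    someEarlier-tr : ∀ φ {a b c} ρ σ (τ : Fin (suc (suc c)) → NSet2) K →
      Holds {suc a} {b} (plug someEarlierSpine (tr φ)) (extend K ρ) σ τ
        ⇔ (Σ ℕ λ j → j < K × (teamOf (τ i₁) ^ᵀ j) ⊨ φ)
    someEarlier-tr φ {a} {b} ρ σ τ K = ∃-⇔ λ j → mk⇔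
      (λ (j<K , h) → j<K , to (shifted j) h) (λ (j<K , h) → j<K , from (shifted j) h)
      where
      shifted : ∀ j → Holds {suc (suc a)} {b} (plug (atShift (var i₂) i₁) (tr φ)) (extend j (extend K ρ)) σ τ
                        ⇔ (teamOf (τ i₁) ^ᵀ j) ⊨ φ
      shifted j = atShift-tr φ (var i₂) i₁ (extend j (extend K ρ)) σ τ j (λ _ _ → refl)

-- Teams of finite Kripke structures

-- Inside kripkeᶠ the first-order variables 0 and 1 hold the root r and the
-- size n, and the second-order variables 0 and 1 the labelling
-- {pair w p ∣ p ∈ η w} and the edges {pair w v ∣ R w v}.
module _ {a b c : ℕ} where

  functionalᶠ startᶠ stepᶠ matchᶠ : Form (suc (suc a)) (suc (suc (suc (suc b)))) c
  functionalᶠ = ∀₁ (∃₁ ((((oneᵗ +ᵗ var i₀) ≤ᶠ var i₃) ∧ᶠ (pairᵗ (var i₁) (var i₀) ∈₁ i₀))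
                       ∧ᶠ ∀₁ ((pairᵗ (var i₂) (var i₀) ∈₁ i₀) ⇒ᶠ (var i₀ =ᶠ var i₁))))
  startᶠ = pairᵗ zeroᵗ (var i₀) ∈₁ i₀
  stepᶠ = ∀₁ (∀₁ (∀₁ (((pairᵗ (var i₂) (var i₁) ∈₁ i₀) ∧ᶠ (pairᵗ (oneᵗ +ᵗ var i₂) (var i₀) ∈₁ i₀))
                      ⇒ᶠ (pairᵗ (var i₁) (var i₀) ∈₁ i₃))))
  matchᶠ = ∀₁ (∀₁ (∀₁ ((pairᵗ (var i₂) (var i₁) ∈₁ i₀) ⇒ᶠ
                       ((pairᵗ (var i₂) (var i₀) ∈₁ i₁) ⇔ᶠ (pairᵗ (var i₁) (var i₀) ∈₁ i₂)))))

  -- set variable 0 codes the trace of a path π, itself coded by {pair i (π i) ∣ i ∈ ℕ}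
  pathTraceᶠ : Form (suc (suc a)) (suc (suc (suc b))) c
  pathTraceᶠ = ∃₂ ((functionalᶠ ∧ᶠ (startᶠ ∧ᶠ stepᶠ)) ∧ᶠ matchᶠ)

  serialᶠ : Form (suc (suc a)) (suc (suc b)) c
  serialᶠ = ∀₁ (¬ᶠ ((oneᵗ +ᵗ var i₀) ≤ᶠ var i₂) ∨ᶠ
                ∃₁ (((oneᵗ +ᵗ var i₀) ≤ᶠ var i₃) ∧ᶠ (pairᵗ (var i₁) (var i₀) ∈₁ i₁)))

kripkeᶠ : ∀ {a b c} → Form a b (suc c)
kripkeᶠ = ∃₁ (∃₁ (∃₂ (∃₂ (((oneᵗ +ᵗ var i₀) ≤ᶠ var i₁) ∧ᶠ (serialᶠ ∧ᶠ comprehensionᶠ i₀ pathTraceᶠ)))))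

record Codes (K : Kripke) (r : ℕ) (Rs Es : NSet) : Set where
  open Kripke K
  field
    root≡ : toℕ root ≡ r
    edges≡ : ∀ w v → Rs (pair (toℕ w) (toℕ v)) ≡ R w v
    labels≡ : ∀ w p → Es (pair (toℕ w) p) ≡ η w p

traces-≈ₜ : ∀ K {t t′} → t ≈ₜ t′ → traces K t → traces K t′
traces-≈ₜ K t≈t′ (π , π₀ , steps , labels) = π , π₀ , steps , λ i p → trans (sym (t≈t′ i p)) (labels i p)

module KripkeSemantics (em : ExcludedMiddle (lsuc 0ℓ)) where
  open Classical em
  open Semantics em
  open Equivalence using (to; from)

  module _ {a b c} (K : Kripke) r Rs Es (codes : Codes K r Rs Es)
           (ρ : Fin a → ℕ) (σ : Fin b → NSet) (τ : Fin c → NSet2) (u : NSet) where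
    open Kripke K
    open Codes codes

    private
      ρ₃ : ℕ → ℕ → ℕ → Fin (suc (suc (suc (suc (suc a))))) → ℕ
      ρ₃ i x y = extend y (extend x (extend i (extend r (extend size ρ))))
      σ₁ : NSet → Fin (suc (suc (suc (suc b)))) → NSet
      σ₁ P = extend P (extend u (extend Es (extend Rs σ)))
      Holds-⇒ᶠ₃ : ∀ (θ θ′ : Form (suc (suc (suc (suc (suc a))))) (suc (suc (suc (suc b)))) c) i x y P →
        Holds (θ ⇒ᶠ θ′) (ρ₃ i x y) (σ₁ P) τ ⇔ (Holds θ (ρ₃ i x y) (σ₁ P) τ → Holds θ′ (ρ₃ i x y) (σ₁ P) τ)
      Holds-⇒ᶠ₃ θ θ′ i x y P = Holds-⇒ᶠ θ θ′ (ρ₃ i x y) (σ₁ P) τ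
      matchBody stepPremise : Form (suc (suc (suc (suc (suc a))))) (suc (suc (suc (suc b)))) c
      matchBody = (pairᵗ (var i₂) (var i₀) ∈₁ i₁) ⇔ᶠ (pairᵗ (var i₁) (var i₀) ∈₁ i₂)
      stepPremise = (pairᵗ (var i₂) (var i₁) ∈₁ i₀) ∧ᶠ (pairᵗ (oneᵗ +ᵗ var i₂) (var i₀) ∈₁ i₀)

    path⇒trace : Holds pathTraceᶠ (extend r (extend size ρ)) (extend u (extend Es (extend Rs σ))) τ →
                 traces K (decode u)
    path⇒trace (P , (functional , start , steps) , match) = π , π₀ , edges , labels
      where
      xs : ℕ → ℕ
      xs i = proj₁ (functional i)
      xs<n : ∀ i → xs i < size
      xs<n i = proj₁ (proj₁ (proj₂ (functional i)))
      P-xs : ∀ i → P (pair i (xs i)) ≡ true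
      P-xs i = proj₂ (proj₁ (proj₂ (functional i)))
      P-unique : ∀ i y → P (pair i y) ≡ true → y ≡ xs i
      P-unique i y = to (Holds-⇒ᶠ₃ (pairᵗ (var i₂) (var i₀) ∈₁ i₀) (var i₀ =ᶠ var i₁) i (xs i) y P)
                        (proj₂ (proj₂ (functional i)) y)
      π : ℕ → Fin size
      π i = fromℕ< (xs<n i)
      toℕ-π : ∀ i → toℕ (π i) ≡ xs i
      toℕ-π i = toℕ-fromℕ< (xs<n i)
      π₀ : π 0 ≡ root
      π₀ = toℕ-injective (trans (toℕ-π 0) (trans (sym (P-unique 0 r start)) (sym root≡)))
      edges : ∀ i → R (π i) (π (suc i)) ≡ true
      edges i = trans (sym (edges≡ (π i) (π (suc i))))
        (subst₂ (λ x y → Rs (pair x y) ≡ true) (sym (toℕ-π i)) (sym (toℕ-π (suc i)))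
          (to (Holds-⇒ᶠ₃ stepPremise (pairᵗ (var i₁) (var i₀) ∈₁ i₃) i (xs i) (xs (suc i)) P)
              (steps i (xs i) (xs (suc i))) (P-xs i , P-xs (suc i))))
      labels : ∀ i p → decode u i p ≡ η (π i) p
      labels i p = trans
        (⇔→≡ (to (Holds-⇔ᶠ (pairᵗ (var i₂) (var i₀) ∈₁ i₁) (pairᵗ (var i₁) (var i₀) ∈₁ i₂) (ρ₃ i (xs i) p) (σ₁ P) τ)
                 (to (Holds-⇒ᶠ₃ (pairᵗ (var i₂) (var i₁) ∈₁ i₀) matchBody i (xs i) p P)
                     (match i (xs i) p) (P-xs i))))
        (trans (cong (λ x → Es (pair x p)) (sym (toℕ-π i))) (labels≡ (π i) p))

    trace⇒path : traces K (decode u) →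
                 Holds pathTraceᶠ (extend r (extend size ρ)) (extend u (extend Es (extend Rs σ))) τ
    trace⇒path (π , π₀ , edges , labels) = P , (functional , start , steps) , match
      where
      P : NSet
      P z = χ (Σ ℕ λ i → pair i (toℕ (π i)) ≡ z)
      P-unique : ∀ i y → P (pair i y) ≡ true → y ≡ toℕ (π i)
      P-unique i y Piy with to (χ-true _) Piy
      ... | i′ , eq with pair-injective {i′} {toℕ (π i′)} {i} {y} eq
      ... | refl , π≡y = sym π≡y
      P-π : ∀ i → P (pair i (toℕ (π i))) ≡ true
      P-π i = from (χ-true _) (i , refl)
      functional : Holds functionalᶠ (extend r (extend size ρ)) (σ₁ P) τ
      functional i = toℕ (π i) , (toℕ<n (π i) , P-π i) , λ y →
        from (Holds-⇒ᶠ₃ (pairᵗ (var i₂) (var i₀) ∈₁ i₀) (var i₀ =ᶠ var i₁) i (toℕ (π i)) y P) (P-unique i y)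
      start : P (pair 0 r) ≡ true
      start = subst (λ x → P (pair 0 x) ≡ true) (trans (cong toℕ π₀) root≡) (P-π 0)
      steps : Holds stepᶠ (extend r (extend size ρ)) (σ₁ P) τ
      steps i x y = from (Holds-⇒ᶠ₃ stepPremise (pairᵗ (var i₁) (var i₀) ∈₁ i₃) i x y P) λ (Pix , Piy) →
        subst₂ (λ x′ y′ → Rs (pair x′ y′) ≡ true) (sym (P-unique i x Pix)) (sym (P-unique (suc i) y Piy))
          (trans (edges≡ (π i) (π (suc i))) (edges i))
      match : Holds matchᶠ (extend r (extend size ρ)) (σ₁ P) τ
      match i x p = from (Holds-⇒ᶠ₃ (pairᵗ (var i₂) (var i₁) ∈₁ i₀) matchBody i x p P) λ Pix →
        from (Holds-⇔ᶠ (pairᵗ (var i₂) (var i₀) ∈₁ i₁) (pairᵗ (var i₁) (var i₀) ∈₁ i₂) (ρ₃ i x p) (σ₁ P) τ)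
          (≡-⇔ (trans (labels i p) (trans (sym (labels≡ (π i) p))
                  (cong (λ z → Es (pair z p)) (sym (P-unique i x Pix))))))

  pathTraceᶠ-correct : ∀ {a b c} (K : Kripke) r Rs Es → Codes K r Rs Es →
    ∀ (ρ : Fin a → ℕ) (σ : Fin b → NSet) (τ : Fin c → NSet2) u →
    Holds pathTraceᶠ (extend r (extend (Kripke.size K) ρ)) (extend u (extend Es (extend Rs σ))) τ
      ⇔ traces K (decode u)
  pathTraceᶠ-correct K r Rs Es codes ρ σ τ u =
    mk⇔ (path⇒trace K r Rs Es codes ρ σ τ u) (trace⇒path K r Rs Es codes ρ σ τ u)

  teamOf-traces : ∀ K A → (∀ v → A v ≡ true ⇔ traces K (decode v)) → teamOf A ≃ᵀ traces K
  teamOf-traces K A A≡ =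
      (λ t (v , Av , v≈t) → decode v , to (A≡ v) Av , ≈ₜ-sym v≈t)
    , (λ t Kt → t , (encode t , from (A≡ (encode t)) (traces-≈ₜ K (≈ₜ-sym (decode-encode t)) Kt)
                    , decode-encode t) , ≈ₜ-refl)

  kripkeᶠ-sound : ∀ {a b c} ρ σ (τ : Fin (suc c) → NSet2) → Holds {a} {b} kripkeᶠ ρ σ τ →
    Σ Kripke λ K → teamOf (τ i₀) ≃ᵀ traces K
  kripkeᶠ-sound ρ σ τ (n , r , Rs , Es , r<n , serial , team) = K , teamOf-traces K (τ i₀) A≡
    where
    successor : ∀ (w : Fin n) → Σ (Fin n) λ v → Rs (pair (toℕ w) (toℕ v)) ≡ true
    successor w with serial (toℕ w)
    ... | inj₁ w≮n = ⊥-elim (w≮n (toℕ<n w))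
    ... | inj₂ (v , v<n , Rwv) =
      fromℕ< v<n , subst (λ z → Rs (pair (toℕ w) z) ≡ true) (sym (toℕ-fromℕ< v<n)) Rwv
    K : Kripke
    K = record { size = n ; R = λ w v → Rs (pair (toℕ w) (toℕ v)) ; serial = successor
               ; η = λ w p → Es (pair (toℕ w) p) ; root = fromℕ< r<n }
    codes : Codes K r Rs Es
    codes = record { root≡ = toℕ-fromℕ< r<n ; edges≡ = λ _ _ → refl ; labels≡ = λ _ _ → refl }
    A≡ : ∀ v → τ i₀ v ≡ true ⇔ traces K (decode v)
    A≡ v = ⇔-trans (to (Holds-comprehension i₀ pathTraceᶠ (extend r (extend n ρ)) (extend Es (extend Rs σ)) τ) team v)
                   (pathTraceᶠ-correct K r Rs Es codes ρ σ τ v)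

  kripkeᶠ-complete : ∀ {a b c} ρ σ (τ : Fin c → NSet2) (K : Kripke) →
    Σ NSet2 λ A → Holds {a} {b} kripkeᶠ ρ σ (extend A τ) × teamOf A ≃ᵀ traces K
  kripkeᶠ-complete ρ σ τ K =
    A , (size , toℕ root , Rs , Es , toℕ<n root , serialᶠ-holds , team) , teamOf-traces K A (λ _ → χ-true _)
    where
    open Kripke K
    Rs Es : NSet
    Rs z = χ (Σ (Fin size) λ w → Σ (Fin size) λ v → pair (toℕ w) (toℕ v) ≡ z × R w v ≡ true)
    Es z = χ (Σ (Fin size) λ w → Σ ℕ λ p → pair (toℕ w) p ≡ z × η w p ≡ true)
    edges≡ : ∀ w v → Rs (pair (toℕ w) (toℕ v)) ≡ R w v
    edges≡ w v = ⇔→≡ (mk⇔ sound λ Rwv → from (χ-true _) (w , v , refl , Rwv))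
      where
      sound : Rs (pair (toℕ w) (toℕ v)) ≡ true → R w v ≡ true
      sound e with to (χ-true _) e
      ... | w′ , v′ , eq , Rwv′ with pair-injective {toℕ w′} {toℕ v′} {toℕ w} {toℕ v} eq
      ... | w≡ , v≡ with toℕ-injective w≡ | toℕ-injective v≡
      ... | refl | refl = Rwv′
    labels≡ : ∀ w p → Es (pair (toℕ w) p) ≡ η w p
    labels≡ w p = ⇔→≡ (mk⇔ sound λ ηwp → from (χ-true _) (w , p , refl , ηwp))
      where
      sound : Es (pair (toℕ w) p) ≡ true → η w p ≡ true
      sound e with to (χ-true _) e
      ... | w′ , p′ , eq , ηwp′ with pair-injective {toℕ w′} {p′} {toℕ w} {p} eq
      ... | w≡ , refl with toℕ-injective w≡
      ... | refl = ηwp′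
    codes : Codes K (toℕ root) Rs Es
    codes = record { root≡ = refl ; edges≡ = edges≡ ; labels≡ = labels≡ }
    A : NSet2
    A v = χ (traces K (decode v))
    serialᶠ-holds : ∀ w → ¬ (w < size) ⊎ Σ ℕ λ v → v < size × Rs (pair w v) ≡ true
    serialᶠ-holds w with w <? size
    ... | no w≮n = inj₁ w≮n
    ... | yes w<n with serial (fromℕ< w<n)
    ... | v , Rwv = inj₂ (toℕ v , toℕ<n v ,
          subst (λ z → Rs (pair z (toℕ v)) ≡ true) (toℕ-fromℕ< w<n) (trans (edges≡ _ v) Rwv))
    team : Holds (comprehensionᶠ i₀ pathTraceᶠ) (extend (toℕ root) (extend size ρ)) (extend Es (extend Rs σ))
                 (extend A τ)
    team = from (Holds-comprehension i₀ pathTraceᶠ (extend (toℕ root) (extend size ρ))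
                                     (extend Es (extend Rs σ)) (extend A τ))
                λ v → ⇔-trans (χ-true _) (⇔-sym (pathTraceᶠ-correct K (toℕ root) Rs Es codes ρ σ (extend A τ) v))

sentence : Spine (0 , 0 , 0) (0 , 0 , 1) → LTL → Sentence
sentence C φ = plug C (tr φ)

satSpine finSatSpine : Spine (0 , 0 , 0) (0 , 0 , 1)
satSpine    = ∃₃∙ ∙
finSatSpine = ∃₃∙ kripkeᶠ ∧∙ ∙

module _ (em : ExcludedMiddle (lsuc 0ℓ)) where
  open Semantics em
  open KripkeSemantics em
  open Equivalence using (to; from)

  satisfiable⇔true : ∀ φ → Satisfiable φ ⇔ TrueInℕ (sentence satSpine φ)
  satisfiable⇔true φ = mk⇔
    (λ (T , T⊨φ) → _ , from (tr-correct φ _ _ _) (⊨-≃ᵀ φ (teamOf-≃ᵀ T) T⊨φ))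
    (λ (A , h) → teamOf A , to (tr-correct φ _ _ _) h)

  finSatisfiable⇔true : ∀ φ → FinSatisfiable φ ⇔ TrueInℕ (sentence finSatSpine φ)
  finSatisfiable⇔true φ = mk⇔
    (λ (K , K⊨φ) → let (A , isK , A≃K) = kripkeᶠ-complete {0} {0} {0} (λ ()) (λ ()) (λ ()) K in
       A , isK , from (tr-correct φ _ _ _) (⊨-≃ᵀ φ (≃ᵀ-sym A≃K) K⊨φ))
    (λ (A , isK , h) → let (K , A≃K) = kripkeᶠ-sound {0} {0} {0} (λ ()) (λ ()) (extend A (λ ())) isK in
       K , ⊨-≃ᵀ φ A≃K (to (tr-correct φ _ _ _) h))

-- Unique readability of the encodings

Symbol : Set
Symbol = Fin ΣA

encTerm′ : ∀ {n} → Term n → List Symbol → List Symbol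
encTerm′ (var i)  r = # 3 ∷ encIdx (toℕ i) ++ r
encTerm′ zeroᵗ    r = # 4 ∷ r
encTerm′ oneᵗ     r = # 5 ∷ r
encTerm′ (s +ᵗ u) r = # 6 ∷ encTerm′ s (encTerm′ u r)
encTerm′ (s ×ᵗ u) r = # 7 ∷ encTerm′ s (encTerm′ u r)

encForm′ : ∀ {a b c} → Form a b c → List Symbol → List Symbol
encForm′ (s =ᶠ u) r = # 8 ∷ encTerm′ s (encTerm′ u r)
encForm′ (s ≤ᶠ u) r = # 9 ∷ encTerm′ s (encTerm′ u r)
encForm′ (s ∈₁ X) r = # 10 ∷ encTerm′ s (encIdx (toℕ X) ++ r)
encForm′ (X ∈₂ Y) r = # 11 ∷ encIdx (toℕ X) ++ encIdx (toℕ Y) ++ r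
encForm′ (¬ᶠ θ)   r = # 12 ∷ encForm′ θ r
encForm′ (θ ∧ᶠ ψ) r = # 13 ∷ encForm′ θ (encForm′ ψ r)
encForm′ (θ ∨ᶠ ψ) r = # 14 ∷ encForm′ θ (encForm′ ψ r)
encForm′ (∃₁ θ)   r = # 15 ∷ encForm′ θ r
encForm′ (∀₁ θ)   r = # 16 ∷ encForm′ θ r
encForm′ (∃₂ θ)   r = # 17 ∷ encForm′ θ r
encForm′ (∀₂ θ)   r = # 18 ∷ encForm′ θ r
encForm′ (∃₃ θ)   r = # 19 ∷ encForm′ θ r
encForm′ (∀₃ θ)   r = # 20 ∷ encForm′ θ r

++-assoc-∷ : ∀ {A : Set} x (u v w : List A) → x ∷ (u ++ v) ++ w ≡ x ∷ u ++ v ++ w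
++-assoc-∷ x u v w = cong (x ∷_) (++-assoc u v w)

encTerm′-correct : ∀ {n} (t : Term n) r → encTerm′ t r ≡ encTerm t ++ r
encTerm′-correct (var i)  r = refl
encTerm′-correct zeroᵗ    r = refl
encTerm′-correct oneᵗ     r = refl
encTerm′-correct (s +ᵗ u) r rewrite encTerm′-correct u r | encTerm′-correct s (encTerm u ++ r) =
  sym (++-assoc-∷ (# 6) (encTerm s) (encTerm u) r)
encTerm′-correct (s ×ᵗ u) r rewrite encTerm′-correct u r | encTerm′-correct s (encTerm u ++ r) =
  sym (++-assoc-∷ (# 7) (encTerm s) (encTerm u) r)

encForm′-correct : ∀ {a b c} (θ : Form a b c) r → encForm′ θ r ≡ encForm θ ++ r
encForm′-correct (s =ᶠ u) r rewrite encTerm′-correct u r | encTerm′-correct s (encTerm u ++ r) =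
  sym (++-assoc-∷ (# 8) (encTerm s) (encTerm u) r)
encForm′-correct (s ≤ᶠ u) r rewrite encTerm′-correct u r | encTerm′-correct s (encTerm u ++ r) =
  sym (++-assoc-∷ (# 9) (encTerm s) (encTerm u) r)
encForm′-correct (s ∈₁ X) r rewrite encTerm′-correct s (encIdx (toℕ X) ++ r) =
  sym (++-assoc-∷ (# 10) (encTerm s) (encIdx (toℕ X)) r)
encForm′-correct (X ∈₂ Y) r = sym (++-assoc-∷ (# 11) (encIdx (toℕ X)) (encIdx (toℕ Y)) r)
encForm′-correct (¬ᶠ θ)   r = cong (# 12 ∷_) (encForm′-correct θ r)
encForm′-correct (θ ∧ᶠ ψ) r rewrite encForm′-correct ψ r | encForm′-correct θ (encForm ψ ++ r) =
  sym (++-assoc-∷ (# 13) (encForm θ) (encForm ψ) r)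
encForm′-correct (θ ∨ᶠ ψ) r rewrite encForm′-correct ψ r | encForm′-correct θ (encForm ψ ++ r) =
  sym (++-assoc-∷ (# 14) (encForm θ) (encForm ψ) r)
encForm′-correct (∃₁ θ)   r = cong (# 15 ∷_) (encForm′-correct θ r)
encForm′-correct (∀₁ θ)   r = cong (# 16 ∷_) (encForm′-correct θ r)
encForm′-correct (∃₂ θ)   r = cong (# 17 ∷_) (encForm′-correct θ r)
encForm′-correct (∀₂ θ)   r = cong (# 18 ∷_) (encForm′-correct θ r)
encForm′-correct (∃₃ θ)   r = cong (# 19 ∷_) (encForm′-correct θ r)
encForm′-correct (∀₃ θ)   r = cong (# 20 ∷_) (encForm′-correct θ r)

encForm′-++ : ∀ {a b c} (θ : Form a b c) r r′ → encForm′ θ (r ++ r′) ≡ encForm′ θ r ++ r′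
encForm′-++ θ r r′ = begin
  encForm′ θ (r ++ r′)   ≡⟨ encForm′-correct θ (r ++ r′) ⟩
  encForm θ ++ r ++ r′   ≡⟨ ++-assoc (encForm θ) r r′ ⟨
  (encForm θ ++ r) ++ r′ ≡⟨ cong (_++ r′) (encForm′-correct θ r) ⟨
  encForm′ θ r ++ r′     ∎
  where open ≡-Reasoning

-- What an encoding must look like after its first symbol, by symbol number.
PeelTerm : ∀ {n} → ℕ → Term n → List Symbol → List Symbol → Set
PeelTerm {n} 3 t r L = Σ (Fin n) λ i → t ≡ var i × encIdx (toℕ i) ++ r ≡ L
PeelTerm     4 t r L = t ≡ zeroᵗ × r ≡ L
PeelTerm     5 t r L = t ≡ oneᵗ × r ≡ L
PeelTerm {n} 6 t r L = Σ (Term n) λ s → Σ (Term n) λ u → t ≡ s +ᵗ u × encTerm′ s (encTerm′ u r) ≡ L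
PeelTerm {n} 7 t r L = Σ (Term n) λ s → Σ (Term n) λ u → t ≡ s ×ᵗ u × encTerm′ s (encTerm′ u r) ≡ L
PeelTerm     _ t r L = ⊥

peelTerm : ∀ {n} (t : Term n) r x L → encTerm′ t r ≡ x ∷ L → PeelTerm (toℕ x) t r L
peelTerm (var i)  r _ _ refl = i , refl , refl
peelTerm zeroᵗ    r _ _ refl = refl , refl
peelTerm oneᵗ     r _ _ refl = refl , refl
peelTerm (s +ᵗ u) r _ _ refl = s , u , refl , refl
peelTerm (s ×ᵗ u) r _ _ refl = s , u , refl , refl

Unary : ∀ {a b c a′ b′ c′} → (Form a′ b′ c′ → Form a b c) → Form a b c → List Symbol → List Symbol → Set
Unary {a′ = a′} {b′} {c′} op θ r L = Σ (Form a′ b′ c′) λ θ₁ → θ ≡ op θ₁ × encForm′ θ₁ r ≡ L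

Binary : ∀ {a b c} → (Form a b c → Form a b c → Form a b c) → Form a b c → List Symbol → List Symbol → Set
Binary {a} {b} {c} op θ r L =
  Σ (Form a b c) λ θ₁ → Σ (Form a b c) λ θ₂ → θ ≡ op θ₁ θ₂ × encForm′ θ₁ (encForm′ θ₂ r) ≡ L

Atomic : ∀ {a b c} → (Term a → Term a → Form a b c) → Form a b c → List Symbol → List Symbol → Set
Atomic {a} op θ r L = Σ (Term a) λ s → Σ (Term a) λ u → θ ≡ op s u × encTerm′ s (encTerm′ u r) ≡ L

PeelForm : ∀ {a b c} → ℕ → Form a b c → List Symbol → List Symbol → Set
PeelForm         8  θ r L = Atomic _=ᶠ_ θ r L
PeelForm         9  θ r L = Atomic _≤ᶠ_ θ r L
PeelForm {a} {b} 10 θ r L = Σ (Term a) λ s → Σ (Fin b) λ X → θ ≡ s ∈₁ X × encTerm′ s (encIdx (toℕ X) ++ r) ≡ L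
PeelForm {b = b} {c} 11 θ r L =
  Σ (Fin b) λ X → Σ (Fin c) λ Y → θ ≡ X ∈₂ Y × encIdx (toℕ X) ++ encIdx (toℕ Y) ++ r ≡ L
PeelForm         12 θ r L = Unary ¬ᶠ θ r L
PeelForm         13 θ r L = Binary _∧ᶠ_ θ r L
PeelForm         14 θ r L = Binary _∨ᶠ_ θ r L
PeelForm         15 θ r L = Unary ∃₁ θ r L
PeelForm         16 θ r L = Unary ∀₁ θ r L
PeelForm         17 θ r L = Unary ∃₂ θ r L
PeelForm         18 θ r L = Unary ∀₂ θ r L
PeelForm         19 θ r L = Unary ∃₃ θ r L
PeelForm         20 θ r L = Unary ∀₃ θ r L
PeelForm         _  θ r L = ⊥

peelForm : ∀ {a b c} (θ : Form a b c) r x L → encForm′ θ r ≡ x ∷ L → PeelForm (toℕ x) θ r L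
peelForm (s =ᶠ u) r _ _ refl = s , u , refl , refl
peelForm (s ≤ᶠ u) r _ _ refl = s , u , refl , refl
peelForm (s ∈₁ X) r _ _ refl = s , X , refl , refl
peelForm (X ∈₂ Y) r _ _ refl = X , Y , refl , refl
peelForm (¬ᶠ θ)   r _ _ refl = θ , refl , refl
peelForm (θ ∧ᶠ ψ) r _ _ refl = θ , ψ , refl , refl
peelForm (θ ∨ᶠ ψ) r _ _ refl = θ , ψ , refl , refl
peelForm (∃₁ θ)   r _ _ refl = θ , refl , refl
peelForm (∀₁ θ)   r _ _ refl = θ , refl , refl
peelForm (∃₂ θ)   r _ _ refl = θ , refl , refl
peelForm (∀₂ θ)   r _ _ refl = θ , refl , refl
peelForm (∃₃ θ)   r _ _ refl = θ , refl , refl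
peelForm (∀₃ θ)   r _ _ refl = θ , refl , refl

bdigits-injective : ∀ x y → bdigits x ≡ bdigits y → x ≡ y
bdigits-injective Bin.zero     Bin.zero     _  = refl
bdigits-injective Bin.2[1+ x ] Bin.2[1+ y ] eq = cong Bin.2[1+_] (bdigits-injective x y (∷-injectiveʳ eq))
bdigits-injective Bin.1+[2 x ] Bin.1+[2 y ] eq = cong Bin.1+[2_] (bdigits-injective x y (∷-injectiveʳ eq))
bdigits-injective Bin.zero     Bin.2[1+ _ ] ()
bdigits-injective Bin.zero     Bin.1+[2 _ ] ()
bdigits-injective Bin.2[1+ _ ] Bin.zero     ()
bdigits-injective Bin.2[1+ _ ] Bin.1+[2 _ ] ()
bdigits-injective Bin.1+[2 _ ] Bin.zero     ()
bdigits-injective Bin.1+[2 _ ] Bin.2[1+ _ ] ()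

encDigits : List Bool → List Symbol
encDigits ds = map (λ d → if d then # 1 else # 0) ds ++ [ # 2 ]

encDigits-injective : ∀ ds ds′ r r′ → encDigits ds ++ r ≡ encDigits ds′ ++ r′ → ds ≡ ds′ × r ≡ r′
encDigits-injective []          []           r r′ eq = refl , ∷-injectiveʳ eq
encDigits-injective (true ∷ ds) (true ∷ ds′) r r′ eq with encDigits-injective ds ds′ r r′ (∷-injectiveʳ eq)
... | refl , r≡r′ = refl , r≡r′
encDigits-injective (false ∷ ds) (false ∷ ds′) r r′ eq with encDigits-injective ds ds′ r r′ (∷-injectiveʳ eq)
... | refl , r≡r′ = refl , r≡r′
encDigits-injective []           (true ∷ _)  _ _ ()
encDigits-injective []           (false ∷ _) _ _ ()
encDigits-injective (true ∷ _)   []          _ _ ()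
encDigits-injective (true ∷ _)   (false ∷ _) _ _ ()
encDigits-injective (false ∷ _)  []          _ _ ()
encDigits-injective (false ∷ _)  (true ∷ _)  _ _ ()

encIdx-injective : ∀ m n r r′ → encIdx m ++ r ≡ encIdx n ++ r′ → m ≡ n × r ≡ r′
encIdx-injective m n r r′ eq with encDigits-injective (bdigits (Bin.fromℕ m)) (bdigits (Bin.fromℕ n)) r r′ eq
... | ds≡ , r≡r′ = Bin.fromℕ-injective (bdigits-injective _ _ ds≡) , r≡r′

encFin-injective : ∀ {n} (i j : Fin n) r r′ → encIdx (toℕ i) ++ r ≡ encIdx (toℕ j) ++ r′ → i ≡ j × r ≡ r′
encFin-injective i j r r′ eq with encIdx-injective (toℕ i) (toℕ j) r r′ eq
... | i≡j , r≡r′ = toℕ-injective i≡j , r≡r′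

encTerm′-injective : ∀ {n} (s s′ : Term n) r r′ → encTerm′ s r ≡ encTerm′ s′ r′ → s ≡ s′ × r ≡ r′
encTerm′-injective (var i) s′ r r′ eq with peelTerm s′ r′ _ _ (sym eq)
... | j , refl , eq₁ with encFin-injective i j r r′ (sym eq₁)
... | refl , r≡r′ = refl , r≡r′
encTerm′-injective zeroᵗ s′ r r′ eq with peelTerm s′ r′ _ _ (sym eq)
... | refl , r′≡r = refl , sym r′≡r
encTerm′-injective oneᵗ s′ r r′ eq with peelTerm s′ r′ _ _ (sym eq)
... | refl , r′≡r = refl , sym r′≡r
encTerm′-injective (s +ᵗ u) s′ r r′ eq with peelTerm s′ r′ _ _ (sym eq)
... | s₁ , u₁ , refl , eq₁ with encTerm′-injective s s₁ _ _ (sym eq₁)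
... | refl , eq₂ with encTerm′-injective u u₁ r r′ eq₂
... | refl , r≡r′ = refl , r≡r′
encTerm′-injective (s ×ᵗ u) s′ r r′ eq with peelTerm s′ r′ _ _ (sym eq)
... | s₁ , u₁ , refl , eq₁ with encTerm′-injective s s₁ _ _ (sym eq₁)
... | refl , eq₂ with encTerm′-injective u u₁ r r′ eq₂
... | refl , r≡r′ = refl , r≡r′

encForm′-injective : ∀ {a b c} (θ θ′ : Form a b c) r r′ → encForm′ θ r ≡ encForm′ θ′ r′ → θ ≡ θ′ × r ≡ r′
encForm′-injective θ θ′ r r′ eq = go θ θ′ r r′ eq
  where
  unary : ∀ {a b c a′ b′ c′} (op : Form a′ b′ c′ → Form a b c) θ₁ θ′ r r′ →
    Unary op θ′ r′ (encForm′ θ₁ r) → op θ₁ ≡ θ′ × r ≡ r′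
  binary : ∀ {a b c} (op : Form a b c → Form a b c → Form a b c) θ₁ θ₂ θ′ r r′ →
    Binary op θ′ r′ (encForm′ θ₁ (encForm′ θ₂ r)) → op θ₁ θ₂ ≡ θ′ × r ≡ r′
  atomic : ∀ {a b c} (op : Term a → Term a → Form a b c) s u θ′ r r′ →
    Atomic op θ′ r′ (encTerm′ s (encTerm′ u r)) → op s u ≡ θ′ × r ≡ r′
  go : ∀ {a b c} (θ θ′ : Form a b c) r r′ → encForm′ θ r ≡ encForm′ θ′ r′ → θ ≡ θ′ × r ≡ r′
  unary op θ₁ θ′ r r′ (θ₂ , refl , eq) with go θ₁ θ₂ r r′ (sym eq)
  ... | refl , r≡r′ = refl , r≡r′
  binary op θ₁ θ₂ θ′ r r′ (θ₃ , θ₄ , refl , eq) with go θ₁ θ₃ _ _ (sym eq)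
  ... | refl , eq₁ with go θ₂ θ₄ r r′ eq₁
  ... | refl , r≡r′ = refl , r≡r′
  atomic op s u θ′ r r′ (s₁ , u₁ , refl , eq) with encTerm′-injective s s₁ _ _ (sym eq)
  ... | refl , eq₁ with encTerm′-injective u u₁ r r′ eq₁
  ... | refl , r≡r′ = refl , r≡r′
  go (s =ᶠ u) θ′ r r′ eq = atomic _=ᶠ_ s u θ′ r r′ (peelForm θ′ r′ _ _ (sym eq))
  go (s ≤ᶠ u) θ′ r r′ eq = atomic _≤ᶠ_ s u θ′ r r′ (peelForm θ′ r′ _ _ (sym eq))
  go (s ∈₁ X) θ′ r r′ eq with peelForm θ′ r′ _ _ (sym eq)
  ... | s₁ , X₁ , refl , eq₁ with encTerm′-injective s s₁ _ _ (sym eq₁)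
  ... | refl , eq₂ with encFin-injective X X₁ r r′ eq₂
  ... | refl , r≡r′ = refl , r≡r′
  go (X ∈₂ Y) θ′ r r′ eq with peelForm θ′ r′ _ _ (sym eq)
  ... | X₁ , Y₁ , refl , eq₁ with encFin-injective X X₁ _ _ (sym eq₁)
  ... | refl , eq₂ with encFin-injective Y Y₁ r r′ eq₂
  ... | refl , r≡r′ = refl , r≡r′
  go (¬ᶠ θ)   θ′ r r′ eq = unary ¬ᶠ θ θ′ r r′ (peelForm θ′ r′ _ _ (sym eq))
  go (θ ∧ᶠ ψ) θ′ r r′ eq = binary _∧ᶠ_ θ ψ θ′ r r′ (peelForm θ′ r′ _ _ (sym eq))
  go (θ ∨ᶠ ψ) θ′ r r′ eq = binary _∨ᶠ_ θ ψ θ′ r r′ (peelForm θ′ r′ _ _ (sym eq))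
  go (∃₁ θ)   θ′ r r′ eq = unary ∃₁ θ θ′ r r′ (peelForm θ′ r′ _ _ (sym eq))
  go (∀₁ θ)   θ′ r r′ eq = unary ∀₁ θ θ′ r r′ (peelForm θ′ r′ _ _ (sym eq))
  go (∃₂ θ)   θ′ r r′ eq = unary ∃₂ θ θ′ r r′ (peelForm θ′ r′ _ _ (sym eq))
  go (∀₂ θ)   θ′ r r′ eq = unary ∀₂ θ θ′ r r′ (peelForm θ′ r′ _ _ (sym eq))
  go (∃₃ θ)   θ′ r r′ eq = unary ∃₃ θ θ′ r r′ (peelForm θ′ r′ _ _ (sym eq))
  go (∀₃ θ)   θ′ r r′ eq = unary ∀₃ θ θ′ r r′ (peelForm θ′ r′ _ _ (sym eq))

spineCode : ∀ {s t} → Spine s t → List Symbol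
spineCode ∙        = []
spineCode (¬∙ C)   = # 12 ∷ spineCode C
spineCode (ξ ∧∙ C) = # 13 ∷ encForm′ ξ (spineCode C)
spineCode (ξ ∨∙ C) = # 14 ∷ encForm′ ξ (spineCode C)
spineCode (∃₁∙ C)  = # 15 ∷ spineCode C
spineCode (∀₁∙ C)  = # 16 ∷ spineCode C
spineCode (∃₂∙ C)  = # 17 ∷ spineCode C
spineCode (∀₂∙ C)  = # 18 ∷ spineCode C
spineCode (∃₃∙ C)  = # 19 ∷ spineCode C
spineCode (∀₃∙ C)  = # 20 ∷ spineCode C

encForm′-plug : ∀ {s t} (C : Spine s t) θ r → encForm′ (plug C θ) r ≡ spineCode C ++ encForm′ θ r
encForm′-plug ∙        θ r = refl
encForm′-plug (¬∙ C)   θ r = cong (# 12 ∷_) (encForm′-plug C θ r)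
encForm′-plug (ξ ∧∙ C) θ r =
  cong (# 13 ∷_) (trans (cong (encForm′ ξ) (encForm′-plug C θ r)) (encForm′-++ ξ (spineCode C) _))
encForm′-plug (ξ ∨∙ C) θ r =
  cong (# 14 ∷_) (trans (cong (encForm′ ξ) (encForm′-plug C θ r)) (encForm′-++ ξ (spineCode C) _))
encForm′-plug (∃₁∙ C)  θ r = cong (# 15 ∷_) (encForm′-plug C θ r)
encForm′-plug (∀₁∙ C)  θ r = cong (# 16 ∷_) (encForm′-plug C θ r)
encForm′-plug (∃₂∙ C)  θ r = cong (# 17 ∷_) (encForm′-plug C θ r)
encForm′-plug (∀₂∙ C)  θ r = cong (# 18 ∷_) (encForm′-plug C θ r)
encForm′-plug (∃₃∙ C)  θ r = cong (# 19 ∷_) (encForm′-plug C θ r)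
encForm′-plug (∀₃∙ C)  θ r = cong (# 20 ∷_) (encForm′-plug C θ r)

Plugged : ∀ {s t} → Spine s t → Formula s → List Symbol → List Symbol → Set
Plugged {t = t} C θ r L = Σ (Formula t) λ θ′ → θ ≡ plug C θ′ × encForm′ θ′ r ≡ L

plug-inverse : ∀ {s t} (C : Spine s t) θ r L → encForm′ θ r ≡ spineCode C ++ L → Plugged C θ r L
plug-inverse-under : ∀ {a b c a′ b′ c′ t} (op : Form a′ b′ c′ → Form a b c) (C : Spine (a′ , b′ , c′) t) {θ} r L →
  Unary op θ r (spineCode C ++ L) → Σ (Formula t) λ θ′ → θ ≡ op (plug C θ′) × encForm′ θ′ r ≡ L
plug-inverse-beside : ∀ {a b c t} (op : Form a b c → Form a b c → Form a b c) ξ (C : Spine (a , b , c) t) {θ} r L →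
  Binary op θ r (encForm′ ξ (spineCode C) ++ L) → Σ (Formula t) λ θ′ → θ ≡ op ξ (plug C θ′) × encForm′ θ′ r ≡ L

plug-inverse ∙        θ r L eq = θ , refl , eq
plug-inverse (¬∙ C)   θ r L eq = plug-inverse-under ¬ᶠ C r L (peelForm θ r _ _ eq)
plug-inverse (ξ ∧∙ C) θ r L eq = plug-inverse-beside _∧ᶠ_ ξ C r L (peelForm θ r _ _ eq)
plug-inverse (ξ ∨∙ C) θ r L eq = plug-inverse-beside _∨ᶠ_ ξ C r L (peelForm θ r _ _ eq)
plug-inverse (∃₁∙ C)  θ r L eq = plug-inverse-under ∃₁ C r L (peelForm θ r _ _ eq)
plug-inverse (∀₁∙ C)  θ r L eq = plug-inverse-under ∀₁ C r L (peelForm θ r _ _ eq)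
plug-inverse (∃₂∙ C)  θ r L eq = plug-inverse-under ∃₂ C r L (peelForm θ r _ _ eq)
plug-inverse (∀₂∙ C)  θ r L eq = plug-inverse-under ∀₂ C r L (peelForm θ r _ _ eq)
plug-inverse (∃₃∙ C)  θ r L eq = plug-inverse-under ∃₃ C r L (peelForm θ r _ _ eq)
plug-inverse (∀₃∙ C)  θ r L eq = plug-inverse-under ∀₃ C r L (peelForm θ r _ _ eq)

plug-inverse-under op C r L (θ₁ , refl , eq) =
  let (θ′ , θ₁≡ , eq′) = plug-inverse C θ₁ r L eq in θ′ , cong op θ₁≡ , eq′

plug-inverse-beside op ξ C r L (θ₁ , θ₂ , refl , eq)
  with encForm′-injective θ₁ ξ _ _ (trans eq (sym (encForm′-++ ξ (spineCode C) L)))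
... | refl , eq₁ = let (θ′ , θ₂≡ , eq′) = plug-inverse C θ₂ r L eq₁ in θ′ , cong (op ξ) θ₂≡ , eq′

connectSymbol : Connective → Symbol
connectSymbol ∧ᶜ = # 13
connectSymbol ∨ᶜ = # 14

connect-inverse : ∀ {a b c} κ (θ : Form a b c) r L → encForm′ θ r ≡ connectSymbol κ ∷ L → Binary (connect κ) θ r L
connect-inverse ∧ᶜ θ r L eq = peelForm θ r _ _ eq
connect-inverse ∨ᶜ θ r L eq = peelForm θ r _ _ eq

binaryCode : ∀ {s a b c t} → Spine s (a , b , c) → Connective → Spine (a , b , c) t → List Symbol
binaryCode C κ D = spineCode C ++ connectSymbol κ ∷ spineCode D

encForm′-plug₂ : ∀ {a b c a′ b′ c′ t} (C : Spine (a , b , c) (a′ , b′ , c′)) κ (D : Spine (a′ , b′ , c′) t) θ θ′ r →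
  encForm′ (plug₂ C κ D θ θ′) r ≡ binaryCode C κ D ++ encForm′ θ (encForm′ θ′ r)
encForm′-plug₂ C κ D θ θ′ r = begin
  encForm′ (plug₂ C κ D θ θ′) r
    ≡⟨ encForm′-plug C (connect κ (plug D θ) θ′) r ⟩
  spineCode C ++ encForm′ (connect κ (plug D θ) θ′) r
    ≡⟨ cong (spineCode C ++_) (connective κ) ⟩
  spineCode C ++ connectSymbol κ ∷ spineCode D ++ encForm′ θ (encForm′ θ′ r)
    ≡⟨ ++-assoc (spineCode C) (connectSymbol κ ∷ spineCode D) _ ⟨
  binaryCode C κ D ++ encForm′ θ (encForm′ θ′ r) ∎
  where
  open ≡-Reasoning
  connective : ∀ κ → encForm′ (connect κ (plug D θ) θ′) r ≡ connectSymbol κ ∷ spineCode D ++ encForm′ θ (encForm′ θ′ r)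
  connective ∧ᶜ = cong (# 13 ∷_) (encForm′-plug D θ (encForm′ θ′ r))
  connective ∨ᶜ = cong (# 14 ∷_) (encForm′-plug D θ (encForm′ θ′ r))

plug₂-inverse : ∀ {a b c a′ b′ c′ t} (C : Spine (a , b , c) (a′ , b′ , c′)) κ (D : Spine (a′ , b′ , c′) t) θ r L →
  encForm′ θ r ≡ binaryCode C κ D ++ L →
  Σ (Formula t) λ θ₁ → Σ (Form a′ b′ c′) λ θ₂ → θ ≡ plug₂ C κ D θ₁ θ₂ × encForm′ θ₁ (encForm′ θ₂ r) ≡ L
plug₂-inverse C κ D θ r L eq =
  let (θ′ , θ≡ , eq₁) = plug-inverse C θ r _ (trans eq (++-assoc (spineCode C) (connectSymbol κ ∷ spineCode D) L))
      (θ₃ , θ₂ , θ′≡ , eq₂) = connect-inverse κ θ′ r _ eq₁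
      (θ₁ , θ₃≡ , eq₃) = plug-inverse D θ₃ (encForm′ θ₂ r) L eq₂
  in θ₁ , θ₂ , trans θ≡ (cong (plug C) (trans θ′≡ (cong (λ ξ → connect κ ξ θ₂) θ₃≡))) , eq₃

-- The reduction on strings

pattern L-prop     = fz
pattern L-digit₁   = fs L-prop
pattern L-digit₂   = fs L-digit₁
pattern L-end      = fs L-digit₂
pattern L-neg      = fs L-end
pattern L-and      = fs L-neg
pattern L-or       = fs L-and
pattern L-next     = fs L-or
pattern L-future   = fs L-next
pattern L-globally = fs L-future
pattern L-until    = fs L-globally
pattern L-release  = fs L-until
pattern L-not      = fs L-release

digitSymbol : Bool → Fin ΣL
digitSymbol d = if d then L-digit₂ else L-digit₁

-- the part of numeralᵗ (d ∷ ds) in front of numeralᵗ ds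
digitCode : Bool → List Symbol
digitCode d = # 6 ∷ encTerm′ (digitᵗ {0} d) (# 7 ∷ encTerm (twoᵗ {0}))

-- the part of the encoding of tr φ contributed by one symbol of φ
block : Fin ΣL → List Symbol
block L-prop     = spineCode (propSpine {0} {0} {0}) ++ # 8 ∷ encTerm (var {1} i₀)
block L-digit₁   = digitCode false
block L-digit₂   = digitCode true
block L-end      = encTerm (zeroᵗ {0})
block L-neg      = spineCode (negSpine {0} {0} {0})
block L-and      = [ # 13 ]
block L-or       = binaryCode (splitSpine {0} {0} {0}) ∧ᶜ copySpine
block L-next     = spineCode (nextSpine {0} {0} {0})
block L-future   = spineCode (someShiftSpine {0} {0} {0})
block L-globally = spineCode (everyShiftSpine {0} {0} {0})
block L-until    = binaryCode (someShiftSpine {0} {0} {0}) ∧ᶜ everyEarlierSpine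
block L-release  = binaryCode (everyShiftSpine {0} {0} {0}) ∨ᶜ someEarlierSpine
block L-not      = [ # 12 ]

blocks : List (Fin ΣL) → List Symbol
blocks = concatMap block

numeralᵗ-blocks : ∀ {n} ds r → encTerm′ (numeralᵗ {n} ds) r ≡ blocks (map digitSymbol ds ++ [ L-end ]) ++ r
numeralᵗ-blocks []           r = refl
numeralᵗ-blocks (false ∷ ds) r = cong (digitCode false ++_) (numeralᵗ-blocks ds r)
numeralᵗ-blocks (true ∷ ds)  r = cong (digitCode true ++_) (numeralᵗ-blocks ds r)

unary-blocks : ∀ {a b c a′ b′ c′} x (C : Spine (a , b , c) (a′ , b′ , c′)) → block x ≡ spineCode C →
  ∀ θ u r → encForm′ θ r ≡ blocks u ++ r → encForm′ (plug C θ) r ≡ blocks (x ∷ u) ++ r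
unary-blocks x C block≡ θ u r θ≡ = begin
  encForm′ (plug C θ) r           ≡⟨ encForm′-plug C θ r ⟩
  spineCode C ++ encForm′ θ r     ≡⟨ cong (spineCode C ++_) θ≡ ⟩
  spineCode C ++ blocks u ++ r    ≡⟨ ++-assoc (spineCode C) (blocks u) r ⟨
  (spineCode C ++ blocks u) ++ r  ≡⟨ cong (λ L → (L ++ blocks u) ++ r) block≡ ⟨
  blocks (x ∷ u) ++ r             ∎
  where open ≡-Reasoning

binary-blocks : ∀ {a b c a′ b′ c′ t} x (C : Spine (a , b , c) (a′ , b′ , c′)) κ (D : Spine (a′ , b′ , c′) t) →
  block x ≡ binaryCode C κ D → ∀ θ θ′ u u′ r →
  (∀ r → encForm′ θ r ≡ blocks u ++ r) → encForm′ θ′ r ≡ blocks u′ ++ r →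
  encForm′ (plug₂ C κ D θ θ′) r ≡ blocks (x ∷ u ++ u′) ++ r
binary-blocks x C κ D block≡ θ θ′ u u′ r θ≡ θ′≡ = begin
  encForm′ (plug₂ C κ D θ θ′) r                    ≡⟨ encForm′-plug₂ C κ D θ θ′ r ⟩
  binaryCode C κ D ++ encForm′ θ (encForm′ θ′ r)   ≡⟨ cong (binaryCode C κ D ++_) (trans (θ≡ _) (cong (blocks u ++_) θ′≡)) ⟩
  binaryCode C κ D ++ blocks u ++ blocks u′ ++ r   ≡⟨ cong (binaryCode C κ D ++_) (++-assoc (blocks u) (blocks u′) r) ⟨
  binaryCode C κ D ++ (blocks u ++ blocks u′) ++ r ≡⟨ cong (λ L → binaryCode C κ D ++ L ++ r) (concatMap-++ block u u′) ⟨
  binaryCode C κ D ++ blocks (u ++ u′) ++ r        ≡⟨ ++-assoc (binaryCode C κ D) (blocks (u ++ u′)) r ⟨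
  (binaryCode C κ D ++ blocks (u ++ u′)) ++ r      ≡⟨ cong (λ L → (L ++ blocks (u ++ u′)) ++ r) block≡ ⟨
  blocks (x ∷ u ++ u′) ++ r                        ∎
  where open ≡-Reasoning

tr-blocks : ∀ φ {a b c} r → encForm′ (tr {a} {b} {c} φ) r ≡ blocks (encLTL φ) ++ r
tr-blocks (prop p) r =
  cong (spineCode (propSpine {0} {0} {0}) ++_) (cong (λ L → # 8 ∷ # 3 ∷ encIdx 0 ++ L) (numeralᵗ-blocks (bdigits (Bin.fromℕ p)) r))
tr-blocks (neg φ)  r = unary-blocks L-neg negSpine refl (tr φ) (encLTL φ) r (tr-blocks φ r)
tr-blocks (φ ∧ᴸ ψ) r = binary-blocks L-and ∙ ∧ᶜ ∙ refl (tr φ) (tr ψ) (encLTL φ) (encLTL ψ) r (tr-blocks φ) (tr-blocks ψ r)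
tr-blocks (φ ∨ᴸ ψ) r =
  binary-blocks L-or splitSpine ∧ᶜ copySpine refl (tr φ) (tr ψ) (encLTL φ) (encLTL ψ) r (tr-blocks φ) (tr-blocks ψ r)
tr-blocks (Xᴸ φ)   r = unary-blocks L-next nextSpine refl (tr φ) (encLTL φ) r (tr-blocks φ r)
tr-blocks (Fᴸ φ)   r = unary-blocks L-future someShiftSpine refl (tr φ) (encLTL φ) r (tr-blocks φ r)
tr-blocks (Gᴸ φ)   r = unary-blocks L-globally everyShiftSpine refl (tr φ) (encLTL φ) r (tr-blocks φ r)
tr-blocks (φ Uᴸ ψ) r = binary-blocks L-until someShiftSpine ∧ᶜ everyEarlierSpine refl
  (tr φ) (tr ψ) (encLTL φ) (encLTL ψ) r (tr-blocks φ) (tr-blocks ψ r)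
tr-blocks (φ Rᴸ ψ) r = binary-blocks L-release everyShiftSpine ∨ᶜ someEarlierSpine refl
  (tr φ) (tr ψ) (encLTL φ) (encLTL ψ) r (tr-blocks φ) (tr-blocks ψ r)
tr-blocks (∼ᴸ φ)   r = unary-blocks L-not (¬∙ ∙) refl (tr φ) (encLTL φ) r (tr-blocks φ r)

undigits : List Bool → Bin.ℕᵇ
undigits []           = Bin.zero
undigits (true ∷ ds)  = Bin.2[1+ undigits ds ]
undigits (false ∷ ds) = Bin.1+[2 undigits ds ]

bdigits-undigits : ∀ ds → bdigits (Bin.fromℕ (Bin.toℕ (undigits ds))) ≡ ds
bdigits-undigits ds = trans (cong bdigits (Bin.fromℕ-toℕ (undigits ds))) (go ds)
  where
  go : ∀ ds → bdigits (undigits ds) ≡ ds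
  go []           = refl
  go (true ∷ ds)  = cong (true ∷_) (go ds)
  go (false ∷ ds) = cong (false ∷_) (go ds)

encTerm′-≢[] : ∀ {n} (t : Term n) r → [] ≢ encTerm′ t r
encTerm′-≢[] (var _)  _ ()
encTerm′-≢[] zeroᵗ    _ ()
encTerm′-≢[] oneᵗ     _ ()
encTerm′-≢[] (_ +ᵗ _) _ ()
encTerm′-≢[] (_ ×ᵗ _) _ ()

encForm′-≢[] : ∀ {a b c} (θ : Form a b c) r → [] ≢ encForm′ θ r
encForm′-≢[] (_ =ᶠ _) _ ()
encForm′-≢[] (_ ≤ᶠ _) _ ()
encForm′-≢[] (_ ∈₁ _) _ ()
encForm′-≢[] (_ ∈₂ _) _ ()
encForm′-≢[] (¬ᶠ _)   _ ()
encForm′-≢[] (_ ∧ᶠ _) _ ()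
encForm′-≢[] (_ ∨ᶠ _) _ ()
encForm′-≢[] (∃₁ _)   _ ()
encForm′-≢[] (∀₁ _)   _ ()
encForm′-≢[] (∃₂ _)   _ ()
encForm′-≢[] (∀₂ _)   _ ()
encForm′-≢[] (∃₃ _)   _ ()
encForm′-≢[] (∀₃ _)   _ ()

blocks-digitSymbol : ∀ {n} d w →
  blocks (digitSymbol d ∷ w) ≡ # 6 ∷ encTerm′ (digitᵗ {n} d) (# 7 ∷ encTerm′ (twoᵗ {n}) (blocks w))
blocks-digitSymbol false w = refl
blocks-digitSymbol true  w = refl

NumeralParsed : ∀ {n} → List (Fin ΣL) → Term n → List Symbol → Set
NumeralParsed w s r = Σ (List Bool) λ ds → Σ (List (Fin ΣL)) λ w′ →
  w ≡ map digitSymbol ds ++ L-end ∷ w′ × s ≡ numeralᵗ ds × r ≡ blocks w′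

parse-numeral : ∀ {n} w (s : Term n) r → blocks w ≡ encTerm′ s r → NumeralParsed w s r
parse-digit : ∀ {n} d w (s : Term n) r → blocks (digitSymbol d ∷ w) ≡ encTerm′ s r →
  NumeralParsed (digitSymbol d ∷ w) s r

parse-numeral []               s r eq = ⊥-elim (encTerm′-≢[] s r eq)
parse-numeral (L-digit₁ ∷ w)   s r eq = parse-digit false w s r eq
parse-numeral (L-digit₂ ∷ w)   s r eq = parse-digit true w s r eq
parse-numeral (L-end ∷ w)      s r eq with peelTerm s r _ _ (sym eq)
... | refl , r≡ = [] , w , refl , refl , r≡
parse-numeral (L-prop ∷ w)     s r eq = ⊥-elim (peelTerm s r _ _ (sym eq))
parse-numeral (L-neg ∷ w)      s r eq = ⊥-elim (peelTerm s r _ _ (sym eq))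
parse-numeral (L-and ∷ w)      s r eq = ⊥-elim (peelTerm s r _ _ (sym eq))
parse-numeral (L-or ∷ w)       s r eq = ⊥-elim (peelTerm s r _ _ (sym eq))
parse-numeral (L-next ∷ w)     s r eq = ⊥-elim (peelTerm s r _ _ (sym eq))
parse-numeral (L-future ∷ w)   s r eq = ⊥-elim (peelTerm s r _ _ (sym eq))
parse-numeral (L-globally ∷ w) s r eq = ⊥-elim (peelTerm s r _ _ (sym eq))
parse-numeral (L-until ∷ w)    s r eq = ⊥-elim (peelTerm s r _ _ (sym eq))
parse-numeral (L-release ∷ w)  s r eq = ⊥-elim (peelTerm s r _ _ (sym eq))
parse-numeral (L-not ∷ w)      s r eq = ⊥-elim (peelTerm s r _ _ (sym eq))

parse-digit {n} d w s r eq with peelTerm s r _ _ (trans (sym eq) (blocks-digitSymbol {n} d w))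
... | s₁ , u₁ , refl , eq₁ with encTerm′-injective s₁ (digitᵗ d) _ _ eq₁
... | refl , eq₂ with peelTerm u₁ r _ _ eq₂
... | s₂ , u₂ , refl , eq₃ with encTerm′-injective s₂ twoᵗ _ _ eq₃
... | refl , eq₄ with parse-numeral w u₂ r (sym eq₄)
... | ds , w′ , refl , refl , r≡ = d ∷ ds , w′ , refl , refl , r≡

Parsed : ∀ {a b c} → List (Fin ΣL) → Form a b (suc c) → List Symbol → Set
Parsed w θ r = Σ LTL λ φ → Σ (List (Fin ΣL)) λ w′ → w ≡ encLTL φ ++ w′ × θ ≡ tr φ × r ≡ blocks w′

Parser : ℕ → Set
Parser n = ∀ w {a b c} (θ : Form a b (suc c)) r → length w ≤ n → blocks w ≡ encForm′ θ r → Parsed w θ r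

parse-prop : ∀ w {a b c} (θ : Form a b (suc c)) r → blocks (L-prop ∷ w) ≡ encForm′ θ r → Parsed (L-prop ∷ w) θ r
parse-prop w θ r eq with plug-inverse propSpine θ r _ (sym eq)
... | θ₁ , refl , eq₁ with peelForm θ₁ r _ _ eq₁
... | s , u , refl , eq₂ with encTerm′-injective s (var i₀) _ _ eq₂
... | refl , eq₃ with parse-numeral w u r (sym eq₃)
... | ds , w′ , refl , refl , r≡ =
  prop p , w′ ,
  cong (L-prop ∷_) (trans (cong (λ ds → map digitSymbol ds ++ L-end ∷ w′) (sym digits≡))
                          (sym (++-assoc (map digitSymbol (bdigits (Bin.fromℕ p))) [ L-end ] w′))) ,
  cong (λ ds → plug propSpine (var i₀ =ᶠ numeralᵗ ds)) (sym digits≡) , r≡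
  where
  p : ℕ
  p = Bin.toℕ (undigits ds)
  digits≡ : bdigits (Bin.fromℕ p) ≡ ds
  digits≡ = bdigits-undigits ds

parse-unary : ∀ {n a b c a′ b′ c′} x (op : LTL → LTL) (C : Spine (a , b , suc c) (a′ , b′ , suc c′)) →
  block x ≡ spineCode C → (∀ φ → encLTL (op φ) ≡ x ∷ encLTL φ) → (∀ φ → tr (op φ) ≡ plug C (tr φ)) →
  Parser n → ∀ w θ r → length w ≤ n → blocks (x ∷ w) ≡ encForm′ θ r → Parsed (x ∷ w) θ r
parse-unary x op C block≡ enc≡ tr≡ parse w θ r w≤n eq =
  let (θ₁ , θ≡ , eq₁) = plug-inverse C θ r (blocks w) (sym (trans (cong (_++ blocks w) (sym block≡)) eq))
      (φ , w′ , w≡ , θ₁≡ , r≡) = parse w θ₁ r w≤n (sym eq₁)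
  in op φ , w′ , trans (cong (x ∷_) w≡) (cong (_++ w′) (sym (enc≡ φ))) ,
     trans θ≡ (trans (cong (plug C) θ₁≡) (sym (tr≡ φ))) , r≡

parse-binary : ∀ {n a b c a′ b′ c′ a″ b″ c″} x (op : LTL → LTL → LTL)
  (C : Spine (a , b , suc c) (a′ , b′ , suc c′)) κ (D : Spine (a′ , b′ , suc c′) (a″ , b″ , suc c″)) →
  block x ≡ binaryCode C κ D → (∀ φ ψ → encLTL (op φ ψ) ≡ x ∷ encLTL φ ++ encLTL ψ) →
  (∀ φ ψ → tr (op φ ψ) ≡ plug₂ C κ D (tr φ) (tr ψ)) →
  Parser n → ∀ w θ r → length w ≤ n → blocks (x ∷ w) ≡ encForm′ θ r → Parsed (x ∷ w) θ r
parse-binary {n} x op C κ D block≡ enc≡ tr≡ parse w θ r w≤n eq =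
  let (θ₁ , θ₂ , θ≡ , eq₁) = plug₂-inverse C κ D θ r (blocks w)
                               (sym (trans (cong (_++ blocks w) (sym block≡)) eq))
      (φ , w₁ , w≡ , θ₁≡ , eq₂) = parse w θ₁ (encForm′ θ₂ r) w≤n (sym eq₁)
      w₁≤n : length w₁ ≤ n
      w₁≤n = ≤-trans (length-++-≤ʳ w₁ {encLTL φ}) (subst (λ v → length v ≤ n) w≡ w≤n)
      (ψ , w₂ , w₁≡ , θ₂≡ , r≡) = parse w₁ θ₂ r w₁≤n (sym eq₂)
  in op φ ψ , w₂ ,
     trans (cong (x ∷_) (trans w≡ (trans (cong (encLTL φ ++_) w₁≡) (sym (++-assoc (encLTL φ) (encLTL ψ) w₂)))))
           (cong (_++ w₂) (sym (enc≡ φ ψ))) ,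
     trans θ≡ (trans (cong₂ (plug₂ C κ D) θ₁≡ θ₂≡) (sym (tr≡ φ ψ))) , r≡

parse : ∀ n → Parser n
parse n       []               θ r _          eq = ⊥-elim (encForm′-≢[] θ r eq)
parse zero    (_ ∷ _)          θ r ()         eq
parse (suc n) (L-prop ∷ w)     θ r _          eq = parse-prop w θ r eq
parse (suc n) (L-digit₁ ∷ w)   θ r _          eq = ⊥-elim (peelForm θ r _ _ (sym eq))
parse (suc n) (L-digit₂ ∷ w)   θ r _          eq = ⊥-elim (peelForm θ r _ _ (sym eq))
parse (suc n) (L-end ∷ w)      θ r _          eq = ⊥-elim (peelForm θ r _ _ (sym eq))
parse (suc n) (L-neg ∷ w)      θ r (s≤s w≤n) eq =
  parse-unary L-neg neg negSpine refl (λ _ → refl) (λ _ → refl) (parse n) w θ r w≤n eq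
parse (suc n) (L-and ∷ w)      θ r (s≤s w≤n) eq =
  parse-binary L-and _∧ᴸ_ ∙ ∧ᶜ ∙ refl (λ _ _ → refl) (λ _ _ → refl) (parse n) w θ r w≤n eq
parse (suc n) (L-or ∷ w)       θ r (s≤s w≤n) eq =
  parse-binary L-or _∨ᴸ_ splitSpine ∧ᶜ copySpine refl (λ _ _ → refl) (λ _ _ → refl) (parse n) w θ r w≤n eq
parse (suc n) (L-next ∷ w)     θ r (s≤s w≤n) eq =
  parse-unary L-next Xᴸ nextSpine refl (λ _ → refl) (λ _ → refl) (parse n) w θ r w≤n eq
parse (suc n) (L-future ∷ w)   θ r (s≤s w≤n) eq =
  parse-unary L-future Fᴸ someShiftSpine refl (λ _ → refl) (λ _ → refl) (parse n) w θ r w≤n eq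
parse (suc n) (L-globally ∷ w) θ r (s≤s w≤n) eq =
  parse-unary L-globally Gᴸ everyShiftSpine refl (λ _ → refl) (λ _ → refl) (parse n) w θ r w≤n eq
parse (suc n) (L-until ∷ w)    θ r (s≤s w≤n) eq =
  parse-binary L-until _Uᴸ_ someShiftSpine ∧ᶜ everyEarlierSpine refl (λ _ _ → refl) (λ _ _ → refl)
               (parse n) w θ r w≤n eq
parse (suc n) (L-release ∷ w)  θ r (s≤s w≤n) eq =
  parse-binary L-release _Rᴸ_ everyShiftSpine ∨ᶜ someEarlierSpine refl (λ _ _ → refl) (λ _ _ → refl)
               (parse n) w θ r w≤n eq
parse (suc n) (L-not ∷ w)      θ r (s≤s w≤n) eq =
  parse-unary L-not ∼ᴸ (¬∙ ∙) refl (λ _ → refl) (λ _ → refl) (parse n) w θ r w≤n eq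

-- Letter-to-word homomorphisms in constant space

clamp : ∀ m → ℕ → Fin (suc m)
clamp m n = fromℕ< (s≤s (m⊓n≤m m n))

toℕ-clamp : ∀ {m n} → n ≤ m → toℕ (clamp m n) ≡ n
toℕ-clamp {m} {n} n≤m = trans (toℕ-fromℕ< (s≤s (m⊓n≤m m n))) (m≥n⇒m⊓n≡n n≤m)

drop-∷ : ∀ {A : Set} n (xs : List A) {y ys} → drop n xs ≡ y ∷ ys → drop (suc n) xs ≡ ys
drop-∷ zero    (x ∷ xs) refl = refl
drop-∷ (suc n) (x ∷ xs) eq   = drop-∷ n xs eq

drop-∷⇒< : ∀ {A : Set} n (xs : List A) {y ys} → drop n xs ≡ y ∷ ys → n < length xs
drop-∷⇒< zero    (x ∷ xs) refl = s≤s z≤n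
drop-∷⇒< (suc n) (x ∷ xs) eq   = s≤s (drop-∷⇒< n xs eq)

lookupL-length : ∀ {A : Set} (u : List A) {x v} → lookupL (u ++ x ∷ v) (length u) ≡ just x
lookupL-length []      = refl
lookupL-length (_ ∷ u) = lookupL-length u

lookupL-end : ∀ {A : Set} (u : List A) → lookupL u (length u) ≡ nothing
lookupL-end []      = refl
lookupL-end (_ ∷ u) = lookupL-end u

moveHead-right-< : ∀ {i bound} → i < bound → moveHead right bound i ≡ suc i
moveHead-right-< {i} {bound} i<b with i ≡ᵇ bound in eq
... | false = refl
... | true  = ⊥-elim (<-irrefl (≡ᵇ⇒≡ i bound (subst T (sym eq) _)) i<b)

-- In state fs i the machine writes symbol i of the current word (pre, or h of
-- the letter under the input head); the work head stays on one cell, which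
-- records whether pre has been written.
module Homomorphism {a b : ℕ} (B : ℕ) (pre : List (Fin b)) (h : Fin a → List (Fin b)) where

  pattern prefixPhase = fz
  pattern inputPhase  = fs fz

  Action : Set
  Action = Fin (suc (suc B)) × Move × Fin 2 × Move × Maybe (Fin b)

  halt : Fin 2 → Action
  halt g = fz , stay , g , stay , nothing

  emitFrom : Fin (suc B) → Fin 2 → List (Fin b) → Action
  emitFrom i g []      = fs fz , right , inputPhase , stay , nothing
  emitFrom i g (y ∷ _) = fs (clamp B (suc (toℕ i))) , stay , g , stay , just y

  δ : Fin (suc (suc B)) → Maybe (Fin a) → Fin 2 → Action
  δ fz     _        g           = halt g
  δ (fs i) _        prefixPhase = emitFrom i prefixPhase (drop (toℕ i) pre)
  δ (fs i) nothing  inputPhase  = halt inputPhase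
  δ (fs i) (just x) inputPhase  = emitFrom i inputPhase (drop (toℕ i) (h x))

  isHalt : Fin (suc (suc B)) → Bool
  isHalt fz     = true
  isHalt (fs _) = false

  transducer : Transducer a b
  transducer = record
    { Q = suc (suc B) ; Γ = 2 ; start = fs fz ; halted = isHalt ; blank = prefixPhase ; δ = δ }

  workMove : Action → Move
  workMove (_ , _ , _ , mw , _) = mw

  δ-work-stays : ∀ q x g → workMove (δ q x g) ≡ stay
  δ-work-stays fz     _        _ = refl
  δ-work-stays (fs i) x        prefixPhase with drop (toℕ i) pre
  ... | []    = refl
  ... | _ ∷ _ = refl
  δ-work-stays (fs i) nothing  inputPhase = refl
  δ-work-stays (fs i) (just y) inputPhase with drop (toℕ i) (h y)
  ... | []    = refl
  ... | _ ∷ _ = refl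

  module _ (w : List (Fin a)) where
    open Config

    runs : ℕ → Config transducer
    runs = run transducer w

    wpos-step : ∀ c → wpos c ≡ 0 → wpos (step transducer w c) ≡ 0
    wpos-step (config fz     _  _  _ _) e = e
    wpos-step (config (fs i) ip tp .0 o) refl
      with δ (fs i) (readInput w ip) (tp 0) | δ-work-stays (fs i) (readInput w ip) (tp 0)
    ... | _ , _ , _ , _ , _ | refl = refl

    wpos-run : ∀ m → wpos (runs m) ≡ 0
    wpos-run zero    = refl
    wpos-run (suc m) = wpos-step (runs m) (wpos-run m)

    record Reading (c : Config transducer) (q : Fin (suc (suc B))) (g : Fin 2)
                   (p : ℕ) (o : List (Fin b)) : Set where
      field
        state≡ : state c ≡ q
        ipos≡  : ipos c ≡ p
        wpos≡  : wpos c ≡ 0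
        cell≡  : tape c 0 ≡ g
        out≡   : out c ≡ o

    step-Reading : ∀ {c i g p o q mi g′ y} → Reading c (fs i) g p o →
      δ (fs i) (readInput w p) g ≡ (q , mi , g′ , stay , y) →
      Reading (step transducer w c) q g′ (moveHead mi (suc (length w)) p) (o ++ outSym y)
    step-Reading {config _ _ tp _ _} record { state≡ = refl ; ipos≡ = refl ; wpos≡ = refl ; cell≡ = cell ; out≡ = refl } δ≡
      rewrite cell | δ≡ = record { state≡ = refl ; ipos≡ = refl ; wpos≡ = refl ; cell≡ = refl ; out≡ = refl }

    Reading-out : ∀ {c q g p o o′} → o ≡ o′ → Reading c q g p o → Reading c q g p o′
    Reading-out refl r = r

    emit : ∀ t {i g p o} word ys → length word ≤ B →
      (∀ j → δ (fs j) (readInput w p) g ≡ emitFrom j g (drop (toℕ j) word)) →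
      Reading (runs t) (fs i) g p o → drop (toℕ i) word ≡ ys →
      Σ ℕ λ t′ → Reading (runs t′) (fs fz) inputPhase (moveHead right (suc (length w)) p) (o ++ ys)
    emit t {i} word [] _ δ≡ r d≡ =
      suc t , step-Reading r (trans (δ≡ i) (cong (emitFrom i _) d≡))
    emit t {i} {o = o} word (y ∷ ys) word≤B δ≡ r d≡ =
      let i<word = drop-∷⇒< (toℕ i) word d≡
          r′ = step-Reading r (trans (δ≡ i) (cong (emitFrom i _) d≡))
          (t′ , r″) = emit (suc t) word ys word≤B δ≡ r′
                        (trans (cong (λ n → drop n word) (toℕ-clamp (≤-trans i<word word≤B)))
                               (drop-∷ (toℕ i) word d≡))
      in t′ , Reading-out (++-assoc o [ y ] ys) r″

    letters : ∀ t {o} u v → w ≡ u ++ v → (∀ x → length (h x) ≤ B) →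
      Reading (runs t) (fs fz) inputPhase (suc (length u)) o →
      Σ ℕ λ t′ → Reading (runs t′) (fs fz) inputPhase (suc (length w)) (o ++ concatMap h v)
    letters t {o} u [] w≡ _ r =
      t , Reading-out (sym (++-identityʳ o))
            (subst (λ n → Reading (runs t) (fs fz) inputPhase (suc n) o)
                   (cong length (trans (sym (++-identityʳ u)) (sym w≡))) r)
    letters t {o} u (x ∷ v) w≡ h≤B r =
      let read≡ = trans (cong (λ ws → lookupL ws (length u)) w≡) (lookupL-length u)
          (t′ , r′) = emit t (h x) (h x) (h≤B x) (λ j → cong (λ z → δ (fs j) z inputPhase) read≡) r refl
          u<w : length u < length w
          u<w = subst (length u <_) (sym (trans (cong length w≡) (length-++ u)))
                      (m<m+n (length u) (s≤s z≤n))
          ipos≡ = trans (moveHead-right-< (s≤s u<w))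
                        (cong suc (trans (+-comm 1 (length u)) (sym (length-++ u))))
          (t″ , r″) = letters t′ (u ++ [ x ]) v (trans w≡ (sym (++-assoc u [ x ] v))) h≤B
                        (subst (λ n → Reading (runs t′) (fs fz) inputPhase n (o ++ h x)) ipos≡ r′)
      in t″ , Reading-out (++-assoc o (h x) (concatMap h v)) r″

    halts : length pre ≤ B → (∀ x → length (h x) ≤ B) →
      Σ ℕ λ n → (isHalt (state (runs n)) ≡ true) × (out (runs n) ≡ pre ++ concatMap h w)
    halts pre≤B h≤B =
      let start = record { state≡ = refl ; ipos≡ = refl ; wpos≡ = refl ; cell≡ = refl ; out≡ = refl }
          (t , r) = emit 0 pre pre pre≤B (λ _ → refl) start refl
          (t′ , r′) = letters t [] w refl h≤B r
          r″ = step-Reading r′ (cong (λ z → δ (fs fz) z inputPhase) (lookupL-end w))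
      in suc t′ , cong isHalt (Reading.state≡ r″) , trans (Reading.out≡ r″) (++-identityʳ _)

  computable : length pre ≤ B → (∀ x → length (h x) ≤ B) →
    LogspaceComputable (λ w → pre ++ concatMap h w)
  computable pre≤B h≤B = transducer , 1 , λ w →
    halts w pre≤B h≤B , λ m → subst (_< _) (sym (wpos-run w m)) (s≤s z≤n)

-- The reductions

encForm′-[] : ∀ {a b c} (θ : Form a b c) → encForm′ θ [] ≡ encForm θ
encForm′-[] θ = trans (encForm′-correct θ []) (++-identityʳ (encForm θ))

blocks-≡[] : ∀ w → blocks w ≡ [] → w ≡ []
blocks-≡[] []      _  = refl
blocks-≡[] (x ∷ w) eq = ⊥-elim (<-irrefl (sym (cong length eq))
  (≤-trans (block-nonempty x) (subst (length (block x) ≤_) (sym (length-++ (block x))) (m≤m+n _ _))))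
  where
  block-nonempty : ∀ x → 0 < length (block x)
  block-nonempty = from-yes (all? λ x → 0 <? length (block x))

encForm-sentence : ∀ C φ → encForm (sentence C φ) ≡ spineCode C ++ blocks (encLTL φ)
encForm-sentence C φ = begin
  encForm (plug C (tr φ))                    ≡⟨ encForm′-[] (plug C (tr φ)) ⟨
  encForm′ (plug C (tr φ)) []                ≡⟨ encForm′-plug C (tr φ) [] ⟩
  spineCode C ++ encForm′ (tr φ) []          ≡⟨ cong (spineCode C ++_) (tr-blocks φ []) ⟩
  spineCode C ++ blocks (encLTL φ) ++ []     ≡⟨ cong (spineCode C ++_) (++-identityʳ _) ⟩
  spineCode C ++ blocks (encLTL φ)           ∎
  where open ≡-Reasoning

sentence-decode : ∀ C w θ → encForm θ ≡ spineCode C ++ blocks w → Σ LTL λ φ → w ≡ encLTL φ × θ ≡ sentence C φ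
sentence-decode C w θ eq
  with plug-inverse C θ [] (blocks w) (trans (encForm′-[] θ) eq)
... | θ₁ , θ≡ , eq₁ with parse (length w) w θ₁ [] ≤-refl (sym eq₁)
... | φ , w′ , w≡ , θ₁≡ , []≡ with blocks-≡[] w′ (sym []≡)
... | refl = φ , trans w≡ (++-identityʳ (encLTL φ)) , trans θ≡ (cong (plug C) θ₁≡)

reduction-correct : ∀ C (P : LTL → Set₁) → (∀ φ → P φ ⇔ TrueInℕ (sentence C φ)) →
  ∀ w → (Σ LTL λ φ → encLTL φ ≡ w × P φ) ⇔ Δ³₀Lang (spineCode C ++ blocks w)
reduction-correct C P P⇔ w = mk⇔
  (λ (φ , φ≡w , Pφ) → sentence C φ , trans (encForm-sentence C φ) (cong (λ v → spineCode C ++ blocks v) φ≡w) ,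
                       Equivalence.to (P⇔ φ) Pφ)
  (λ (θ , θ≡ , trueθ) → let (φ , w≡ , θ≡φ) = sentence-decode C w θ θ≡ in
                        φ , sym w≡ , Equivalence.from (P⇔ φ) (subst TrueInℕ θ≡φ trueθ))

maxBlock : ℕ
maxBlock = 1000

reduction-logspace : ∀ (C : Spine (0 , 0 , 0) (0 , 0 , 1)) → length (spineCode C) ≤ maxBlock →
  LogspaceComputable (λ w → spineCode C ++ blocks w)
reduction-logspace C C≤ = Homomorphism.computable maxBlock (spineCode C) block C≤
  (from-yes (all? λ x → length (block x) ≤? maxBlock))

theorem28 : ExcludedMiddle (lsuc 0ℓ) →
    LogspaceReducible SATLang Δ³₀Lang × LogspaceReducible FinSATLang Δ³₀Lang
theorem28 em =
    ( (λ w → spineCode satSpine ++ blocks w)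
    , reduction-logspace satSpine (from-yes (length (spineCode satSpine) ≤? maxBlock))
    , reduction-correct satSpine Satisfiable (satisfiable⇔true em) )
  , ( (λ w → spineCode finSatSpine ++ blocks w)
    , reduction-logspace finSatSpine (from-yes (length (spineCode finSatSpine) ≤? maxBlock))
    , reduction-correct finSatSpine FinSatisfiable (finSatisfiable⇔true em) )
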